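{- Let $n>1$ be an integer and let $D$ be a set of positive proper divisors of $n$ such that $ICG_n(D)$ is connected. If $a,b\in\mathbb{Z}_n$ satisfy $\gcd(a,n)=\gcd(b,n)$, then $d(0,a)=d(0,b)$. Consequently, for each $p\ge 1$ the set of vertices at distance exactly $p$ from $0$ is of the form $\bigcup_{d\in D^{(p)}} G_n(d)$ for some set $D^{(p)}$ of divisors of $n$, and the distance eigenvalues of $ICG_n(D)$ are $$\mu_r=\sum_{p=1}^{\mathrm{diam}} p\sum_{d\in D^{(p)}} c\!\left(r,\frac{n}{d}\right),\qquad 0\le r\le n-1,$$ where $\mathrm{diam}$ is the diameter of $ICG_n(D)$.
   Context: For an integer $n>1$ and a set $D$ of positive proper divisors of $n$, $ICG_n(D)$ is the graph on vertex set $\mathbb{Z}_n=\{0,\dots,n-1\}$ in which distinct $a,b$ are adjacent iff $\gcd(a-b,n)\in D$. $d(u,v)$ denotes the graph distance. For a divisor $d$ of $n$, $G_n(d)=\{k: 1\le k<n,\ \gcd(k,n)=d\}$. The Ramanujan sum is $c(r,N)=\sum_{1\le a\le N,\ \gcd(a,N)=1} e^{2\pi i a r/N}$. Distance eigenvalues are the eigenvalues of the distance matrix $[d(i,j)]_{i,j}$. -}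

module Defs where

open import Level using (Level)
open import Data.Nat using (ℕ; zero; suc; _≤_; _<_; _%_; _/_; _≡ᵇ_)
open import Data.Nat.GCD using (gcd)
open import Data.Fin using (Fin; zero; suc; toℕ; punchIn; _≟_)
open import Data.List using (List; foldr)
open import Data.List.Membership.Propositional using (_∈_)
open import Data.Bool using (if_then_else_)
open import Data.Product using (_×_; Σ; ∃)
open import Relation.Nullary using (¬_; does)
open import Relation.Binary.PropositionalEquality using (_≡_)
open import Algebra.Bundles using (CommutativeRing)

-- Total versions of mod / div (the divisor is always positive where used)

_%′_ : ℕ → ℕ → ℕ
m %′ zero  = m
m %′ suc k = m % suc k

_/′_ : ℕ → ℕ → ℕ
m /′ zero  = 0
m /′ suc k = m / suc k

-- representative in {0..n-1} of a - b mod n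
diffMod : (n : ℕ) → Fin n → Fin n → ℕ
diffMod n a b = (toℕ a Data.Nat.+ (n Data.Nat.∸ toℕ b)) %′ n

Adj : (n : ℕ) → List ℕ → Fin n → Fin n → Set
Adj n D a b = ¬ (a ≡ b) × (gcd (diffMod n a b) n ∈ D)

data Walk (n : ℕ) (D : List ℕ) : ℕ → Fin n → Fin n → Set where
  nil  : ∀ {u} → Walk n D 0 u u
  cons : ∀ {k u w v} → Adj n D u w → Walk n D k w v → Walk n D (suc k) u v

Connected : (n : ℕ) → List ℕ → Set
Connected n D = ∀ u v → ∃ λ k → Walk n D k u v

IsDist : (n : ℕ) → List ℕ → Fin n → Fin n → ℕ → Set
IsDist n D u v k = Walk n D k u v × (∀ j → j < k → ¬ Walk n D j u v)

IsDistFun : (n : ℕ) → List ℕ → (Fin n → Fin n → ℕ) → Set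
IsDistFun n D dist = ∀ u v → IsDist n D u v (dist u v)

IsDiam : (n : ℕ) → (Fin n → Fin n → ℕ) → ℕ → Set
IsDiam n dist diam = (∀ u v → dist u v ≤ diam) × Σ (Fin n) λ u → Σ (Fin n) λ v → dist u v ≡ diam

vzero : ∀ {n} → 1 < n → Fin n
vzero {suc n} _ = zero

InG : (n : ℕ) → ℕ → Fin n → Set
InG n d k = 1 ≤ toℕ k × gcd (toℕ k) n ≡ d

module RingDefs {c ℓ : Level} (R : CommutativeRing c ℓ) where
  open CommutativeRing R using (Carrier; _≈_; _+_; _*_; _-_; -_; 0#; 1#)

  pow : Carrier → ℕ → Carrier
  pow x zero    = 1#
  pow x (suc k) = x * pow x k

  nat : ℕ → Carrier
  nat zero    = 0#
  nat (suc k) = 1# + nat k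

  ∑ : ∀ {m} → (Fin m → Carrier) → Carrier
  ∑ {zero}  f = 0#
  ∑ {suc m} f = f zero + ∑ (λ i → f (suc i))

  ∏ : ∀ {m} → (Fin m → Carrier) → Carrier
  ∏ {zero}  f = 1#
  ∏ {suc m} f = f zero * ∏ (λ i → f (suc i))

  sumL : List ℕ → (ℕ → Carrier) → Carrier
  sumL xs f = foldr (λ d acc → f d + acc) 0# xs

  sign : ℕ → Carrier
  sign zero    = 1#
  sign (suc k) = - sign k

  det : ∀ {m} → (Fin m → Fin m → Carrier) → Carrier
  det {zero}  M = 1#
  det {suc m} M = ∑ λ j → sign (toℕ j) * (M zero j * det (λ i k → M (suc i) (punchIn j k)))

  charPoly : ∀ {m} → (Fin m → Fin m → Carrier) → Carrier → Carrier
  charPoly M x = det (λ i j → (if does (i ≟ j) then x else 0#) - M i j)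

  IsField : Set (c Level.⊔ ℓ)
  IsField = ¬ (1# ≈ 0#) × (∀ x → ¬ (x ≈ 0#) → Σ Carrier λ y → x * y ≈ 1#)

  PrimitiveRoot : ℕ → Carrier → Set ℓ
  PrimitiveRoot n ω = (pow ω n ≈ 1#) × (∀ k → 0 < k → k < n → ¬ (pow ω k ≈ 1#))

  ramanujan : Carrier → ℕ → ℕ → Carrier
  ramanujan ζ r N = ∑ {N} λ a →
    if gcd (suc (toℕ a)) N ≡ᵇ 1 then pow ζ (suc (toℕ a) Data.Nat.* r) else 0#

  -- μ_r = Σ_{p=1}^{diam} p Σ_{d ∈ D^(p)} c(r, n/d), with c computed from ζ_{n/d} = ω^d
  mu : (n : ℕ) → Carrier → (ℕ → List ℕ) → ℕ → ℕ → Carrier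
  mu n ω Dp diam r = ∑ {diam} λ q →
    nat (suc (toℕ q)) * sumL (Dp (suc (toℕ q))) (λ d → ramanujan (pow ω d) r (n /′ d))

  -- "the distance eigenvalues of ICG_n(D) are μ_0,…,μ_{n-1}":
  -- det(x I - Dist) = ∏_{r=0}^{n-1} (x - μ_r), in any field with a primitive n-th root ω
  DistanceSpectrum : (n : ℕ) → (Fin n → Fin n → ℕ) → (ℕ → List ℕ) → ℕ → Set (c Level.⊔ ℓ)
  DistanceSpectrum n dist Dp diam =
    IsField → (ω : Carrier) → PrimitiveRoot n ω → (x : Carrier) →
      charPoly (λ i j → nat (dist i j)) x ≈ ∏ {n} (λ r → x - mu n ω Dp diam (toℕ r))

module Submission where

-- Every affine map x ↦ u x + c of ℤ_N with u a unit preserves gcd (x - y, N), so it is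
-- an automorphism of ICG_N(D) and preserves distances. The translations make the distance
-- matrix circulant, and since residues a, b with gcd (a, N) = gcd (b, N) satisfy a = u b
-- for a unit u, d(0, a) depends only on gcd (a, N). For a primitive N-th root of unity ω
-- the vectors (ω^(j r))_j therefore diagonalise x I - Dist, with eigenvalues x - μ_r where
-- μ_r = ∑_k d(0, k) ω^(k r); grouping k first by distance and then by gcd (k, N) turns μ_r
-- into ∑_p p ∑_{d ∈ D⁽ᵖ⁾} c(r, N/d). Over a field these eigenvectors form an invertible
-- Vandermonde matrix, which gives det (x I - Dist) = ∏_r (x - μ_r).

open import Level using (Level)
open import Algebra.Bundles using (CommutativeRing)
open import Data.Nat using (ℕ; suc; _≤_; _<_)
open import Data.Nat.GCD using (gcd)
open import Data.Nat.Divisibility using (_∣_)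
open import Data.Fin using (Fin; toℕ)
open import Data.List using (List)
open import Data.List.Relation.Unary.All as All using (All)
open import Data.List.Membership.Propositional using (_∈_)
open import Data.Product using (_×_; Σ; _,_)
open import Function.Bundles using (_⇔_)
open import Relation.Binary.PropositionalEquality using (_≡_)
open import Defs

module Arithmetic where

  open import Data.Nat
  open import Data.Nat.Properties
  open import Data.Nat.DivMod
  open import Data.Nat.Divisibility
  open import Data.Nat.GCD
  open import Data.Nat.Coprimality as Coprime using (Coprime; coprime-divisor; coprime-Bézout; gcd≡1⇒coprime)
  open import Data.Nat.Induction using (<-rec)
  open import Data.Nat.Primality
  open import Data.Nat.Primality.Factorisation using (factorise)
  open import Data.Nat.ListAction using (product)
  open import Data.List using ([]; _∷_)
  open import Data.List.Relation.Unary.All using (_∷_)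
  open import Data.Product using (∃; _×_; _,_)
  open import Data.Sum using (inj₁; inj₂)
  open import Data.Empty using (⊥-elim)
  open import Relation.Nullary using (Dec; yes; no; ¬_)
  open import Relation.Binary.PropositionalEquality
  open import Data.Nat.Solver using (module +-*-Solver)
  open +-*-Solver using (solve; _:+_; _:*_; _:=_; con)

  module _ {N : ℕ} .{{_ : NonZero N}} where

    %-+-congʳ : ∀ x x' y → x % N ≡ x' % N → (x + y) % N ≡ (x' + y) % N
    %-+-congʳ x x' y e = begin
      (x + y) % N          ≡⟨ %-distribˡ-+ x y N ⟩
      (x % N + y % N) % N  ≡⟨ cong (λ z → (z + y % N) % N) e ⟩
      (x' % N + y % N) % N ≡⟨ %-distribˡ-+ x' y N ⟨
      (x' + y) % N         ∎
      where open ≡-Reasoning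

    %-*-congʳ : ∀ x x' y → x % N ≡ x' % N → (x * y) % N ≡ (x' * y) % N
    %-*-congʳ x x' y e = begin
      (x * y) % N              ≡⟨ %-distribˡ-* x y N ⟩
      (x % N * (y % N)) % N    ≡⟨ cong (λ z → (z * (y % N)) % N) e ⟩
      (x' % N * (y % N)) % N   ≡⟨ %-distribˡ-* x' y N ⟨
      (x' * y) % N             ∎
      where open ≡-Reasoning

    m+[N∸m%N]≡[1+m/N]*N : ∀ m → m + (N ∸ m % N) ≡ suc (m / N) * N
    m+[N∸m%N]≡[1+m/N]*N m = begin
      m + (N ∸ m % N)                     ≡⟨ cong (_+ (N ∸ m % N)) (m≡m%n+[m/n]*n m N) ⟩
      (m % N + m / N * N) + (N ∸ m % N)   ≡⟨ solve 3 (λ r q z → (r :+ q) :+ z := q :+ (r :+ z)) refl (m % N) (m / N * N) (N ∸ m % N) ⟩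
      m / N * N + (m % N + (N ∸ m % N))   ≡⟨ cong (m / N * N +_) (m+[n∸m]≡n (m%n≤n m N)) ⟩
      m / N * N + N                       ≡⟨ +-comm (m / N * N) N ⟩
      suc (m / N) * N                     ∎
      where open ≡-Reasoning

    %-+-cancelʳ : ∀ x x' y → (x + y) % N ≡ (x' + y) % N → x % N ≡ x' % N
    %-+-cancelʳ x x' y e = begin
      x % N                        ≡⟨ [m+kn]%n≡m%n x (suc (y / N)) N ⟨
      (x + suc (y / N) * N) % N    ≡⟨ cong (λ w → (x + w) % N) (m+[N∸m%N]≡[1+m/N]*N y) ⟨
      (x + (y + z)) % N            ≡⟨ cong (_% N) (+-assoc x y z) ⟨
      ((x + y) + z) % N            ≡⟨ %-+-congʳ (x + y) (x' + y) z e ⟩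
      ((x' + y) + z) % N           ≡⟨ cong (_% N) (+-assoc x' y z) ⟩
      (x' + (y + z)) % N           ≡⟨ cong (λ w → (x' + w) % N) (m+[N∸m%N]≡[1+m/N]*N y) ⟩
      (x' + suc (y / N) * N) % N   ≡⟨ [m+kn]%n≡m%n x' (suc (y / N)) N ⟩
      x' % N                       ∎
      where open ≡-Reasoning
            z = N ∸ y % N

    %-injective-< : ∀ {x y} → x < N → y < N → x % N ≡ y % N → x ≡ y
    %-injective-< x<N y<N e = trans (sym (m<n⇒m%n≡m x<N)) (trans e (m<n⇒m%n≡m y<N))

    coprime⇒invertible : ∀ {x} → Coprime x N → ∃ λ s → (s * x) % N ≡ 1 % N
    coprime⇒invertible {x} c with coprime-Bézout c
    ... | Bézout.+- a b eq = a , trans (cong (_% N) (sym eq)) ([m+kn]%n≡m%n 1 b N)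
    ... | Bézout.-+ a b eq = a * k , %-+-cancelʳ (a * k * x) 1 k (begin
        (a * k * x + k) % N ≡⟨ cong (_% N) (solve 3 (λ a k x → a :* k :* x :+ k := k :* (con 1 :+ a :* x)) refl a k x) ⟩
        (k * (1 + a * x)) % N ≡⟨ cong (λ z → (k * z) % N) eq ⟩
        (k * (b * N)) % N   ≡⟨ cong (_% N) (sym (*-assoc k b N)) ⟩
        (k * b * N) % N     ≡⟨ m*n%n≡0 (k * b) N ⟩
        0                   ≡⟨ n%n≡0 N ⟨
        N % N               ≡⟨ cong (_% N) (m+[n∸m]≡n (>-nonZero⁻¹ N)) ⟨
        (1 + k) % N         ∎)
      where
      open ≡-Reasoning
      -- Bézout here reads 1 + a x = b N, so a (N - 1) is the inverse of x.
      k = N ∸ 1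

    invertible⇒coprime : ∀ {s x} → (s * x) % N ≡ 1 % N → Coprime x N
    invertible⇒coprime {s} e (d∣x , d∣N) =
      ∣1⇒≡1 (∣n∣m%n⇒∣m d∣N (subst (_ ∣_) e (%-presˡ-∣ (∣n⇒∣m*n s d∣x) d∣N)))

    gcd[m%N,N]≡gcd[m,N] : ∀ m → gcd (m % N) N ≡ gcd m N
    gcd[m%N,N]≡gcd[m,N] m = ∣-antisym
      (gcd-greatest (∣n∣m%n⇒∣m (gcd[m,n]∣n (m % N) N) (gcd[m,n]∣m (m % N) N)) (gcd[m,n]∣n (m % N) N))
      (gcd-greatest (%-presˡ-∣ (gcd[m,n]∣m m N) (gcd[m,n]∣n m N)) (gcd[m,n]∣n m N))

  gcd[gcd[m,n],n]≡gcd[m,n] : ∀ m n → gcd (gcd m n) n ≡ gcd m n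
  gcd[gcd[m,n],n]≡gcd[m,n] m n = ∣-antisym (gcd[m,n]∣m (gcd m n) n) (gcd-greatest ∣-refl (gcd[m,n]∣n m n))

  coprime-*ˡ : ∀ {a b n} → Coprime a n → Coprime b n → Coprime (a * b) n
  coprime-*ˡ ca cb (d∣ab , d∣n) = cb (coprime-divisor (λ (e∣d , e∣a) → ca (e∣a , ∣-trans e∣d d∣n)) d∣ab , d∣n)

  coprime-*ʳ : ∀ {t a b} → Coprime t a → Coprime t b → Coprime t (a * b)
  coprime-*ʳ ca cb = Coprime.sym (coprime-*ˡ (Coprime.sym ca) (Coprime.sym cb))

  gcd[u*m,n]≡gcd[m,n] : ∀ {u n} m → Coprime u n → gcd (u * m) n ≡ gcd m n
  gcd[u*m,n]≡gcd[m,n] {u} {n} m cu = ∣-antisym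
    (gcd-greatest (coprime-divisor g⊥u (gcd[m,n]∣m (u * m) n)) (gcd[m,n]∣n (u * m) n))
    (gcd-greatest (∣n⇒∣m*n u (gcd[m,n]∣m m n)) (gcd[m,n]∣n m n))
    where
    g⊥u : Coprime (gcd (u * m) n) u
    g⊥u (e∣g , e∣u) = cu (e∣u , ∣-trans e∣g (gcd[m,n]∣n (u * m) n))

  prime∤⇒coprime : ∀ {p x} → Prime p → ¬ (p ∣ x) → Coprime x p
  prime∤⇒coprime pp p∤x (d∣x , d∣p) with prime⇒irreducible pp d∣p
  ... | inj₁ d≡1 = d≡1
  ... | inj₂ refl = ⊥-elim (p∤x d∣x)

  ∃-prime-divisor : ∀ q → 2 ≤ q → ∃ λ p → Prime p × p ∣ q
  ∃-prime-divisor q 2≤q with factorise q {{>-nonZero (<-trans z<s 2≤q)}}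
  ... | record { factors = [] ; isFactorisation = e } = ⊥-elim (<⇒≢ 2≤q (sym e))
  ... | record { factors = p ∷ ps ; isFactorisation = e ; factorsPrime = pp ∷ _ } =
    p , pp , divides (product ps) (trans e (*-comm p (product ps)))

  -- Induction on the prime factors of q: a prime p ∣ q either divides t, and then
  -- t + m is prime to p, or it does not; either way recurse with modulus m p and q / p.
  coprime-lift : ∀ q → 1 ≤ q → ∀ m t → Coprime t m → ∃ λ j → Coprime (t + m * j) (m * q)
  coprime-lift = <-rec _ lift
    where
    lift : ∀ q → (∀ {q'} → q' < q → 1 ≤ q' → ∀ m t → Coprime t m → ∃ λ j → Coprime (t + m * j) (m * q')) →
           1 ≤ q → ∀ m t → Coprime t m → ∃ λ j → Coprime (t + m * j) (m * q)
    lift (suc zero) _ _ m t c =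
      0 , subst₂ Coprime (sym (trans (cong (t +_) (*-zeroʳ m)) (+-identityʳ t))) (sym (*-identityʳ m)) c
    lift q@(suc (suc _)) rec _ m t c = byPrime (∃-prime-divisor q (s≤s (s≤s z≤n)))
      where
      byPrime : (∃ λ p → Prime p × p ∣ q) → ∃ λ j → Coprime (t + m * j) (m * q)
      byPrime (p , pp , p∣q@(divides q' q≡q'p)) = byCase (p ∣? t)
        where
        instance _ = prime⇒nonTrivial pp
        recurse : ∀ t' → Coprime t' (m * p) → ∃ λ j → Coprime (t' + m * p * j) (m * q)
        recurse t' c' =
          let j , cj = rec (quotient-< p∣q) (>-nonZero⁻¹ q' {{quotient≢0 p∣q}}) (m * p) t' c'
          in j , subst (Coprime _) mp*q'≡m*q cj
          where
          mp*q'≡m*q : m * p * q' ≡ m * q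
          mp*q'≡m*q = trans (solve 3 (λ m p q' → m :* p :* q' := m :* (q' :* p)) refl m p q')
                            (cong (m *_) (sym q≡q'p))
        byCase : Dec (p ∣ t) → ∃ λ j → Coprime (t + m * j) (m * q)
        byCase (yes p∣t) =
          let j , cj = recurse (t + m) (coprime-*ʳ t+m⊥m (prime∤⇒coprime pp p∤t+m))
          in suc (p * j) , subst (λ z → Coprime z (m * q))
               (solve 4 (λ t m p j → t :+ m :+ m :* p :* j := t :+ m :* (con 1 :+ p :* j)) refl t m p j) cj
          where
          t+m⊥m : Coprime (t + m) m
          t+m⊥m = subst (λ z → Coprime z m) (+-comm m t) (Coprime.coprime-+ c)
          p∤t+m : ¬ (p ∣ t + m)
          p∤t+m p∣t+m = ¬prime[1] (subst Prime (c (p∣t , ∣m+n∣m⇒∣n p∣t+m p∣t)) pp)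
        byCase (no p∤t) =
          let j , cj = recurse t (coprime-*ʳ c (prime∤⇒coprime pp p∤t))
          in p * j , subst (λ z → Coprime z (m * q)) (cong (t +_) (*-assoc m p j)) cj

  -- Invert b' modulo m, then lift the resulting unit s a' modulo m to a unit modulo m g.
  unit-scaling : ∀ m g {a' b'} .{{_ : NonZero m}} .{{_ : NonZero (m * g)}} → 1 ≤ g →
                 Coprime b' m → Coprime a' m → a' < m →
                 ∃ λ u → Coprime u (m * g) × (u * (b' * g)) % (m * g) ≡ a' * g
  unit-scaling m g {a'} {b'} 1≤g b'⊥m a'⊥m a'<m =
    let s , sb'≡1 = coprime⇒invertible b'⊥m
        j , u⊥mg = coprime-lift g 1≤g m (s * a')
                     (coprime-*ˡ (invertible⇒coprime {s = b'} (trans (cong (_% m) (*-comm b' s)) sb'≡1)) a'⊥m)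
    in s * a' + m * j , u⊥mg , (begin
      ((s * a' + m * j) * (b' * g)) % (m * g)
        ≡⟨ cong (_% (m * g)) (solve 6 (λ s a m j b g → (s :* a :+ m :* j) :* (b :* g) := s :* a :* b :* g :+ j :* b :* (m :* g)) refl s a' m j b' g) ⟩
      (s * a' * b' * g + j * b' * (m * g)) % (m * g) ≡⟨ [m+kn]%n≡m%n (s * a' * b' * g) (j * b') (m * g) ⟩
      (s * a' * b' * g) % (m * g)                    ≡⟨ m%n*o≡m*o%[n*o] (s * a' * b') m g ⟨
      (s * a' * b') % m * g                          ≡⟨ cong (λ z → z % m * g) (solve 3 (λ s a b → s :* a :* b := s :* b :* a) refl s a' b') ⟩
      (s * b' * a') % m * g                          ≡⟨ cong (_* g) (%-*-congʳ (s * b') 1 a' sb'≡1) ⟩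
      (1 * a') % m * g                               ≡⟨ cong (λ z → z % m * g) (*-identityˡ a') ⟩
      a' % m * g                                     ≡⟨ cong (_* g) (m<n⇒m%n≡m a'<m) ⟩
      a' * g                                         ∎)
    where open ≡-Reasoning

  gcd≡⇒associated : ∀ n .{{_ : NonZero n}} a b → a < n → gcd a n ≡ gcd b n →
                    ∃ λ u → Coprime u n × (u * b) % n ≡ a
  gcd≡⇒associated n a b a<n gcda≡gcdb with gcd[m,n]∣m b n | gcd[m,n]∣n b n | gcd[m,n]∣m a n
  ... | divides b' b≡b'g | divides m n≡mg | divides a' a≡a'g =
    let u , u⊥mg , ub≡a = unit-scaling m g (>-nonZero⁻¹ g) (quotient⊥ b b' b≡b'g refl) (quotient⊥ a a' a≡a'g gcda≡gcdb) a'<m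
    in u , subst (Coprime u) (sym n≡mg) u⊥mg , (begin
      (u * b) % n               ≡⟨ %-congʳ n≡mg ⟩
      (u * b) % (m * g)         ≡⟨ cong (λ z → (u * z) % (m * g)) b≡b'g ⟩
      (u * (b' * g)) % (m * g)  ≡⟨ ub≡a ⟩
      a' * g                    ≡⟨ cong (a' *_) gcda≡gcdb ⟨
      a' * gcd a n              ≡⟨ a≡a'g ⟨
      a                         ∎)
    where
    open ≡-Reasoning
    g = gcd b n
    instance
      _ : NonZero g
      _ = ≢-nonZero (gcd[m,n]≢0 b n (inj₂ (≢-nonZero⁻¹ n)))
      _ : NonZero (m * g)
      _ = subst NonZero n≡mg (≢-nonZero (≢-nonZero⁻¹ n))
      _ : NonZero m
      _ = m*n≢0⇒m≢0 m {g}
    quotient⊥ : ∀ x x' → x ≡ x' * gcd x n → gcd x n ≡ g → Coprime x' m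
    quotient⊥ x x' x≡x'g gx≡g = gcd≡1⇒coprime (*-cancelˡ-≡ (gcd x' m) 1 g (begin
      g * gcd x' m           ≡⟨ c*gcd[m,n]≡gcd[cm,cn] g x' m ⟩
      gcd (g * x') (g * m)   ≡⟨ cong₂ gcd (*-comm g x') (*-comm g m) ⟩
      gcd (x' * g) (m * g)   ≡⟨ cong₂ gcd (trans (cong (x' *_) (sym gx≡g)) (sym x≡x'g)) (sym n≡mg) ⟩
      gcd x n                ≡⟨ gx≡g ⟩
      g                      ≡⟨ *-identityʳ g ⟨
      g * 1                  ∎))
    a'<m : a' < m
    a'<m = *-cancelʳ-< g a' m (subst₂ _<_ (trans a≡a'g (cong (a' *_) gcda≡gcdb)) n≡mg a<n)

module Determinants {c ℓ : Level} (R : CommutativeRing c ℓ) where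

  open import Level using (_⊔_)
  open import Data.Nat as ℕ using (ℕ; zero; suc)
  open import Data.Nat.Properties using (m+[n∸m]≡n; m<n⇒0<n∸m; ≤-<-trans; m∸n≤m; <⇒≤; <-trans; <-cmp)
  open import Relation.Binary.Definitions using (tri<; tri≈; tri>)
  open import Function using (_∘_)
  open import Data.Fin as Fin using (Fin; zero; suc; toℕ; punchIn; punchOut; inject₁)
  open import Data.Fin.Properties using (toℕ<n; toℕ-injective; toℕ-inject₁; punchOut-punchIn; punchIn-punchOut; punchInᵢ≢i; punchOut-cong; suc-injective)
  open import Data.Vec.Functional using (Vector; _∷_; tail)
  open import Relation.Binary.PropositionalEquality as ≡ using (_≡_; _≢_)
  open import Relation.Nullary using (yes; no)
  open import Data.Empty using (⊥-elim)
  open import Data.Unit.Polymorphic using (⊤)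
  open import Data.Product using (_,_; proj₁; proj₂)
  open import Defs using (module RingDefs)

  open CommutativeRing R hiding (zero)
  open RingDefs R
  open import Algebra.Properties.Ring ring
    using (x∙y⁻¹≈ε⇒x≈y; -‿distribˡ-*; -‿distribʳ-*; -‿involutive; x+x≈x⇒x≈0; -0#≈0#; +-inverseʳ-unique; -‿+-comm)
  open import Algebra.Properties.Semiring.Sum semiring
    using (sum; sum-cong-≋; ∑-distrib-+; ∑-comm; sum-remove; sum-replicate-zero; *-distribˡ-sum; *-distribʳ-sum)
  open import Algebra.Properties.Semiring.Exp semiring using (_^_; ^-homo-*; ^-assocʳ)
  open import Algebra.Solver.Ring.NaturalCoefficients.Default commutativeSemiring
    using (solve; _:+_; _:*_; _:=_)
  open import Data.Vec.Functional.Relation.Binary.Equality.Setoid setoid using (_≋_)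
  open import Relation.Binary.Reasoning.Setoid setoid

  ∑≡sum : ∀ {m} (f : Vector Carrier m) → ∑ f ≡ sum f
  ∑≡sum {zero}  f = ≡.refl
  ∑≡sum {suc m} f = ≡.cong (f zero +_) (∑≡sum (λ i → f (suc i)))

  ∑-cong : ∀ {m} {f g : Vector Carrier m} → f ≋ g → ∑ f ≈ ∑ g
  ∑-cong {f = f} {g} e = begin
    ∑ f   ≡⟨ ∑≡sum f ⟩
    sum f ≈⟨ sum-cong-≋ e ⟩
    sum g ≡⟨ ∑≡sum g ⟨
    ∑ g   ∎

  ∑-≈0 : ∀ {m} {f : Vector Carrier m} → f ≋ (λ _ → 0#) → ∑ f ≈ 0#
  ∑-≈0 {m} e = trans (∑-cong e) (trans (reflexive (∑≡sum {m} (λ _ → 0#))) (sum-replicate-zero m))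

  ∑-+ : ∀ {m} (f g : Vector Carrier m) → ∑ (λ i → f i + g i) ≈ ∑ f + ∑ g
  ∑-+ f g = begin
    ∑ (λ i → f i + g i)   ≡⟨ ∑≡sum (λ i → f i + g i) ⟩
    sum (λ i → f i + g i) ≈⟨ ∑-distrib-+ f g ⟩
    sum f + sum g         ≡⟨ ≡.cong₂ _+_ (∑≡sum f) (∑≡sum g) ⟨
    ∑ f + ∑ g             ∎

  ∑-swap : ∀ {m n} (f : Fin m → Fin n → Carrier) → ∑ (λ i → ∑ (λ j → f i j)) ≈ ∑ (λ j → ∑ (λ i → f i j))
  ∑-swap f = begin
    ∑ (λ i → ∑ (λ j → f i j))     ≈⟨ ∑-cong (λ i → reflexive (∑≡sum (f i))) ⟩
    ∑ (λ i → sum (λ j → f i j))   ≡⟨ ∑≡sum (λ i → sum (f i)) ⟩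
    sum (λ i → sum (λ j → f i j)) ≈⟨ ∑-comm f ⟩
    sum (λ j → sum (λ i → f i j)) ≡⟨ ∑≡sum (λ j → sum (λ i → f i j)) ⟨
    ∑ (λ j → sum (λ i → f i j))   ≈⟨ ∑-cong (λ j → reflexive (∑≡sum (λ i → f i j))) ⟨
    ∑ (λ j → ∑ (λ i → f i j))     ∎

  ∑-remove : ∀ {m} (f : Vector Carrier (suc m)) (i : Fin (suc m)) → ∑ f ≈ f i + ∑ (λ k → f (punchIn i k))
  ∑-remove f i = begin
    ∑ f                           ≡⟨ ∑≡sum f ⟩
    sum f                         ≈⟨ sum-remove f ⟩
    f i + sum (λ k → f (punchIn i k)) ≡⟨ ≡.cong (f i +_) (∑≡sum (λ k → f (punchIn i k))) ⟨
    f i + ∑ (λ k → f (punchIn i k)) ∎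

  *-distribˡ-∑ : ∀ {m} a (f : Vector Carrier m) → a * ∑ f ≈ ∑ (λ i → a * f i)
  *-distribˡ-∑ a f = begin
    a * ∑ f                ≡⟨ ≡.cong (a *_) (∑≡sum f) ⟩
    a * sum f              ≈⟨ *-distribˡ-sum a f ⟩
    sum (λ i → a * f i)    ≡⟨ ∑≡sum (λ i → a * f i) ⟨
    ∑ (λ i → a * f i)      ∎

  *-distribʳ-∑ : ∀ {m} a (f : Vector Carrier m) → ∑ f * a ≈ ∑ (λ i → f i * a)
  *-distribʳ-∑ a f = begin
    ∑ f * a                ≡⟨ ≡.cong (_* a) (∑≡sum f) ⟩
    sum f * a              ≈⟨ *-distribʳ-sum a f ⟩
    sum (λ i → f i * a)    ≡⟨ ∑≡sum (λ i → f i * a) ⟨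
    ∑ (λ i → f i * a)      ∎

  -‿distrib-∑ : ∀ {m} (f : Vector Carrier m) → ∑ (λ i → - f i) ≈ - ∑ f
  -‿distrib-∑ {zero} f = sym -0#≈0#
  -‿distrib-∑ {suc m} f = trans (+-congˡ (-‿distrib-∑ (λ i → f (suc i)))) (-‿+-comm (f zero) _)

  ∑∑-antisymmetric : ∀ {m} (G : Fin m → Fin m → Carrier) →
                     (∀ x → G x x ≈ 0#) → (∀ x y → G y x ≈ - G x y) →
                     ∑ (λ x → ∑ (λ y → G x y)) ≈ 0#
  ∑∑-antisymmetric {zero} G diag anti = refl
  ∑∑-antisymmetric {suc m} G diag anti = begin
    (G zero zero + row₀) + ∑ (λ x → G (suc x) zero + ∑ (λ y → G (suc x) (suc y)))
      ≈⟨ +-cong (+-congʳ (diag zero)) (∑-+ (λ x → G (suc x) zero) _) ⟩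
    (0# + row₀) + (∑ (λ x → G (suc x) zero) + ∑ (λ x → ∑ (λ y → G (suc x) (suc y))))
      ≈⟨ +-cong (+-identityˡ row₀)
                (+-cong (trans (∑-cong (λ x → anti zero (suc x))) (-‿distrib-∑ (λ y → G zero (suc y))))
                        (∑∑-antisymmetric (λ x y → G (suc x) (suc y)) (λ x → diag (suc x)) (λ x y → anti (suc x) (suc y)))) ⟩
    row₀ + (- row₀ + 0#)
      ≈⟨ trans (+-congˡ (+-identityʳ (- row₀))) (-‿inverseʳ row₀) ⟩
    0# ∎
    where row₀ = ∑ (λ y → G zero (suc y))

  δ : ∀ {n} → Fin n → Fin n → Carrier
  δ zero    zero    = 1#
  δ zero    (suc _) = 0#
  δ (suc _) zero    = 0#
  δ (suc i) (suc j) = δ i j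

  δ-refl : ∀ {n} (i : Fin n) → δ i i ≈ 1#
  δ-refl zero = refl
  δ-refl (suc i) = δ-refl i

  δ-≢ : ∀ {n} {i j : Fin n} → i ≢ j → δ i j ≈ 0#
  δ-≢ {i = zero}  {zero}  i≢j = ⊥-elim (i≢j ≡.refl)
  δ-≢ {i = zero}  {suc j} i≢j = refl
  δ-≢ {i = suc i} {zero}  i≢j = refl
  δ-≢ {i = suc i} {suc j} i≢j = δ-≢ (λ e → i≢j (≡.cong suc e))

  δ-sym : ∀ {n} (i j : Fin n) → δ i j ≡ δ j i
  δ-sym zero    zero    = ≡.refl
  δ-sym zero    (suc j) = ≡.refl
  δ-sym (suc i) zero    = ≡.refl
  δ-sym (suc i) (suc j) = δ-sym i j

  δ-punchIn : ∀ {n} (j : Fin (suc n)) (a b : Fin n) → δ (punchIn j a) (punchIn j b) ≡ δ a b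
  δ-punchIn zero    a       b       = ≡.refl
  δ-punchIn (suc j) zero    zero    = ≡.refl
  δ-punchIn (suc j) zero    (suc b) = ≡.refl
  δ-punchIn (suc j) (suc a) zero    = ≡.refl
  δ-punchIn (suc j) (suc a) (suc b) = δ-punchIn j a b

  ∑-*δʳ : ∀ {n} (a : Vector Carrier n) (k : Fin n) → ∑ (λ j → a j * δ j k) ≈ a k
  ∑-*δʳ {suc n} a zero = begin
    a zero * 1# + ∑ (λ j → a (suc j) * 0#) ≈⟨ +-cong (*-identityʳ _) (∑-≈0 (λ j → zeroʳ (a (suc j)))) ⟩
    a zero + 0#                            ≈⟨ +-identityʳ _ ⟩
    a zero                                 ∎
  ∑-*δʳ {suc n} a (suc k) = trans (+-cong (zeroʳ _) (∑-*δʳ (λ j → a (suc j)) k)) (+-identityˡ _)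

  ∑-δ*ˡ : ∀ {n} (b : Vector Carrier n) (i : Fin n) → ∑ (λ l → δ i l * b l) ≈ b i
  ∑-δ*ˡ b i = trans (∑-cong (λ l → trans (*-comm _ _) (*-congˡ (reflexive (δ-sym i l))))) (∑-*δʳ b i)

  Matrix : ℕ → ℕ → Set c
  Matrix m n = Vector (Vector Carrier n) m

  minor : ∀ {m n} → Fin (suc n) → Matrix (suc m) (suc n) → Matrix m n
  minor j M i k = M (suc i) (punchIn j k)

  laplaceTerm : ∀ {m} → Matrix (suc m) (suc m) → Fin (suc m) → Carrier
  laplaceTerm A j = sign (toℕ j) * (A zero j * det (minor j A))

  Extensional : ∀ {m n} → (Matrix m n → Carrier) → Set (c ⊔ ℓ)
  Extensional {m} {n} F = ∀ {A B : Matrix m n} → (∀ r → A r ≋ B r) → F A ≈ F B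

  -- Linearity in row i, phrased without vector operations: row i of A is a B_i + C_i
  -- and the other rows of A, B and C agree.
  Multilinear : ∀ {m n} → (Matrix m n → Carrier) → Set (c ⊔ ℓ)
  Multilinear {m} {n} F = ∀ (i : Fin m) (A B C : Matrix m n) (a : Carrier) →
    (∀ r → r ≢ i → A r ≋ B r) → (∀ r → r ≢ i → A r ≋ C r) →
    (∀ k → A i k ≈ a * B i k + C i k) → F A ≈ a * F B + F C

  Alternating : ∀ {m n} → (Matrix (suc m) n → Carrier) → Set (c ⊔ ℓ)
  Alternating {m} {n} F = ∀ (i : Fin m) (A : Matrix (suc m) n) → A (inject₁ i) ≋ A (suc i) → F A ≈ 0#

  det-cong : ∀ {m} → Extensional (det {m})
  det-cong {zero} e = refl
  det-cong {suc m} {A} {B} e = ∑-cong {f = laplaceTerm A} {laplaceTerm B}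
    (λ j → *-congˡ (*-cong (e zero j) (det-cong (λ i k → e (suc i) (punchIn j k)))))

  laplace-linear : ∀ {m} (A B C : Matrix (suc m) (suc m)) a →
    (∀ j → laplaceTerm A j ≈ a * laplaceTerm B j + laplaceTerm C j) → det A ≈ a * det B + det C
  laplace-linear A B C a terms = begin
    det A                                        ≈⟨ ∑-cong terms ⟩
    ∑ (λ j → a * laplaceTerm B j + laplaceTerm C j) ≈⟨ ∑-+ (λ j → a * laplaceTerm B j) (laplaceTerm C) ⟩
    ∑ (λ j → a * laplaceTerm B j) + det C       ≈⟨ +-congʳ (*-distribˡ-∑ a (laplaceTerm B)) ⟨
    a * det B + det C                            ∎

  det-multilinear : ∀ {m} → Multilinear (det {m})
  det-multilinear {suc m} zero A B C a A≋B A≋C A₀≈ = laplace-linear A B C a λ j → begin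
    sign (toℕ j) * (A zero j * det (minor j A))
      ≈⟨ *-congˡ (*-congʳ (A₀≈ j)) ⟩
    sign (toℕ j) * ((a * B zero j + C zero j) * det (minor j A))
      ≈⟨ solve 5 (λ s a b c d → s :* ((a :* b :+ c) :* d) := a :* (s :* (b :* d)) :+ s :* (c :* d)) refl _ a _ _ _ ⟩
    a * (sign (toℕ j) * (B zero j * det (minor j A))) + sign (toℕ j) * (C zero j * det (minor j A))
      ≈⟨ +-cong (*-congˡ (*-congˡ (*-congˡ (det-cong (λ i k → A≋B (suc i) (λ ()) (punchIn j k))))))
                (*-congˡ (*-congˡ (det-cong (λ i k → A≋C (suc i) (λ ()) (punchIn j k))))) ⟩
    a * laplaceTerm B j + laplaceTerm C j ∎
  det-multilinear {suc m} (suc i) A B C a A≋B A≋C Aᵢ≈ = laplace-linear A B C a λ j → begin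
    sign (toℕ j) * (A zero j * det (minor j A))
      ≈⟨ *-congˡ (*-congˡ (det-multilinear i (minor j A) (minor j B) (minor j C) a
           (λ r r≢i k → A≋B (suc r) (λ e → r≢i (suc-injective e)) (punchIn j k))
           (λ r r≢i k → A≋C (suc r) (λ e → r≢i (suc-injective e)) (punchIn j k))
           (λ k → Aᵢ≈ (punchIn j k)))) ⟩
    sign (toℕ j) * (A zero j * (a * det (minor j B) + det (minor j C)))
      ≈⟨ solve 5 (λ s x a y z → s :* (x :* (a :* y :+ z)) := a :* (s :* (x :* y)) :+ s :* (x :* z)) refl _ _ a _ _ ⟩
    a * (sign (toℕ j) * (A zero j * det (minor j B))) + sign (toℕ j) * (A zero j * det (minor j C))
      ≈⟨ +-cong (*-congˡ (*-congˡ (*-congʳ (A≋B zero (λ ()) j))))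
                (*-congˡ (*-congʳ (A≋C zero (λ ()) j))) ⟩
    a * laplaceTerm B j + laplaceTerm C j ∎

  offDiagonal : ∀ {n} → (Fin (suc n) → Fin n → Carrier) → Fin (suc n) → Fin (suc n) → Carrier
  offDiagonal T x y with x Fin.≟ y
  ... | yes _   = 0#
  ... | no x≢y = T x (punchOut x≢y)

  offDiagonal-diag : ∀ {n} (T : Fin (suc n) → Fin n → Carrier) x → offDiagonal T x x ≈ 0#
  offDiagonal-diag T x with x Fin.≟ x
  ... | yes _   = refl
  ... | no x≢x = ⊥-elim (x≢x ≡.refl)

  offDiagonal-punchIn : ∀ {n} (T : Fin (suc n) → Fin n → Carrier) x k → offDiagonal T x (punchIn x k) ≈ T x k
  offDiagonal-punchIn T x k with x Fin.≟ punchIn x k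
  ... | yes x≡ = ⊥-elim (punchInᵢ≢i x k (≡.sym x≡))
  ... | no x≢  = reflexive (≡.cong (T x) (≡.trans (punchOut-cong x ≡.refl) (punchOut-punchIn x)))

  ∑-offDiagonal : ∀ {n} (T : Fin (suc n) → Fin n → Carrier) x → ∑ (offDiagonal T x) ≈ ∑ (T x)
  ∑-offDiagonal T x = begin
    ∑ (offDiagonal T x)                                   ≈⟨ ∑-remove (offDiagonal T x) x ⟩
    offDiagonal T x x + ∑ (λ k → offDiagonal T x (punchIn x k)) ≈⟨ +-cong (offDiagonal-diag T x) (∑-cong (offDiagonal-punchIn T x)) ⟩
    0# + ∑ (T x)                                          ≈⟨ +-identityˡ _ ⟩
    ∑ (T x)                                               ∎

  sign-punchOut-swap : ∀ {n} (x y : Fin (suc (suc n))) (x≢y : x ≢ y) (y≢x : y ≢ x) →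
    sign (toℕ y) * sign (toℕ (punchOut y≢x)) ≈ - (sign (toℕ x) * sign (toℕ (punchOut x≢y)))
  sign-punchOut-swap zero    zero    x≢y _ = ⊥-elim (x≢y ≡.refl)
  sign-punchOut-swap zero    (suc y) _   _ = trans (*-identityʳ _) (-‿cong (sym (*-identityˡ _)))
  sign-punchOut-swap (suc x) zero    _   _ = trans (*-identityˡ _) (sym (trans (-‿cong (*-identityʳ _)) (-‿involutive _)))
  sign-punchOut-swap {zero}  (suc zero) (suc zero) x≢y _ = ⊥-elim (x≢y ≡.refl)
  sign-punchOut-swap {suc n} (suc x) (suc y) x≢y y≢x = trans (-*-‿ _ _)
    (trans (sign-punchOut-swap x y (λ e → x≢y (≡.cong suc e)) (λ e → y≢x (≡.cong suc e))) (-‿cong (sym (-*-‿ _ _))))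
    where
    -*-‿ : ∀ a b → (- a) * (- b) ≈ a * b
    -*-‿ a b = trans (sym (-‿distribˡ-* a (- b))) (trans (-‿cong (sym (-‿distribʳ-* a b))) (-‿involutive (a * b)))

  punchIn-punchOut-swap : ∀ {n} (x y : Fin (suc (suc n))) (x≢y : x ≢ y) (y≢x : y ≢ x) (l : Fin n) →
    punchIn x (punchIn (punchOut x≢y) l) ≡ punchIn y (punchIn (punchOut y≢x) l)
  punchIn-punchOut-swap zero    zero    x≢y _ l = ⊥-elim (x≢y ≡.refl)
  punchIn-punchOut-swap zero    (suc y) _   _ l = ≡.refl
  punchIn-punchOut-swap (suc x) zero    _   _ l = ≡.refl
  punchIn-punchOut-swap {suc n} (suc x) (suc y) _ _ zero = ≡.refl
  punchIn-punchOut-swap {suc n} (suc x) (suc y) x≢y y≢x (suc l) =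
    ≡.cong suc (punchIn-punchOut-swap x y (λ e → x≢y (≡.cong suc e)) (λ e → y≢x (≡.cong suc e)) l)

  -- Expanding along the two equal first rows writes det A as a double sum whose
  -- (x, y) and (y, x) terms cancel.
  det-alternating : ∀ {m} → Alternating {m} {suc m} det
  det-alternating {suc m} (suc i) A A≋ =
    ∑-≈0 {f = laplaceTerm A} (λ j → trans (*-congˡ (trans (*-congˡ (det-alternating i (minor j A) (λ k → A≋ (punchIn j k)))) (zeroʳ _))) (zeroʳ _))
  det-alternating {suc m} zero A A₀≋A₁ = begin
    det A                                      ≈⟨ ∑-cong expand ⟩
    ∑ (λ x → ∑ (T x))                          ≈⟨ ∑-cong (λ x → sym (∑-offDiagonal T x)) ⟩
    ∑ (λ x → ∑ (offDiagonal T x))              ≈⟨ ∑∑-antisymmetric (offDiagonal T) (offDiagonal-diag T) antisymmetric ⟩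
    0#                                         ∎
    where
    a : Vector Carrier (suc (suc m))
    a = A zero
    D : Fin (suc (suc m)) → Fin (suc m) → Matrix m m
    D j k = minor k (minor j A)
    T : Fin (suc (suc m)) → Fin (suc m) → Carrier
    T j k = sign (toℕ j) * (a j * (sign (toℕ k) * (a (punchIn j k) * det (D j k))))
    expand : ∀ j → laplaceTerm A j ≈ ∑ (T j)
    expand j = begin
      sign (toℕ j) * (a j * det (minor j A))
        ≈⟨ *-congˡ (*-congˡ (∑-cong {f = laplaceTerm (minor j A)} {g = row}
                               (λ k → *-congˡ (*-congʳ (sym (A₀≋A₁ (punchIn j k))))))) ⟩
      sign (toℕ j) * (a j * ∑ row)
        ≈⟨ *-congˡ (*-distribˡ-∑ (a j) row) ⟩
      sign (toℕ j) * ∑ (λ k → a j * row k)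
        ≈⟨ *-distribˡ-∑ (sign (toℕ j)) (λ k → a j * row k) ⟩
      ∑ (T j) ∎
      where
      row : Vector Carrier (suc m)
      row k = sign (toℕ k) * (a (punchIn j k) * det (D j k))
    regroup : ∀ s a t b d → s * (a * (t * (b * d))) ≈ (s * t) * (a * (b * d))
    regroup = solve 5 (λ s a t b d → s :* (a :* (t :* (b :* d))) := (s :* t) :* (a :* (b :* d))) refl
    T-swap : ∀ x y (x≢y : x ≢ y) (y≢x : y ≢ x) → T y (punchOut y≢x) ≈ - T x (punchOut x≢y)
    T-swap x y x≢y y≢x = begin
      T y (punchOut y≢x)
        ≈⟨ regroup _ _ _ _ _ ⟩
      (sign (toℕ y) * sign (toℕ (punchOut y≢x))) * (a y * (a (punchIn y (punchOut y≢x)) * det (D y (punchOut y≢x))))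
        ≈⟨ *-cong (sign-punchOut-swap x y x≢y y≢x)
             (trans (*-congˡ (*-cong (reflexive (≡.cong a (punchIn-punchOut y≢x)))
                       (det-cong (λ i l → reflexive (≡.cong (A (suc (suc i))) (≡.sym (punchIn-punchOut-swap x y x≢y y≢x l)))))))
                    (solve 3 (λ a b d → a :* (b :* d) := b :* (a :* d)) refl _ _ _)) ⟩
      (- (sign (toℕ x) * sign (toℕ (punchOut x≢y)))) * (a x * (a y * det (D x (punchOut x≢y))))
        ≈⟨ -‿distribˡ-* _ _ ⟨
      - ((sign (toℕ x) * sign (toℕ (punchOut x≢y))) * (a x * (a y * det (D x (punchOut x≢y)))))
        ≈⟨ -‿cong (trans (regroup _ _ _ _ _) (*-congˡ (*-congˡ (*-congʳ (reflexive (≡.cong a (punchIn-punchOut x≢y))))))) ⟨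
      - T x (punchOut x≢y) ∎
    antisymmetric : ∀ x y → offDiagonal T y x ≈ - offDiagonal T x y
    antisymmetric x y with x Fin.≟ y | y Fin.≟ x
    ... | yes _   | yes _   = sym -0#≈0#
    ... | yes x≡y | no y≢x  = ⊥-elim (y≢x (≡.sym x≡y))
    ... | no x≢y  | yes y≡x = ⊥-elim (x≢y (≡.sym y≡x))
    ... | no x≢y  | no y≢x  = T-swap x y x≢y y≢x

  module _ {m n : ℕ} {F : Matrix (suc m) n → Carrier} where

    fixHead-extensional : Extensional F → (u : Vector Carrier n) → Extensional (λ T → F (u ∷ T))
    fixHead-extensional ext u e = ext (λ { zero k → refl ; (suc r) k → e r k })

    fixHead-multilinear : Multilinear F → (u : Vector Carrier n) → Multilinear (λ T → F (u ∷ T))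
    fixHead-multilinear lin u i A B C a A≋B A≋C Aᵢ≈ =
      lin (suc i) (u ∷ A) (u ∷ B) (u ∷ C) a
        (λ { zero _ k → refl ; (suc r) r≢ k → A≋B r (λ e → r≢ (≡.cong suc e)) k })
        (λ { zero _ k → refl ; (suc r) r≢ k → A≋C r (λ e → r≢ (≡.cong suc e)) k })
        Aᵢ≈

    private
      headLinear : Multilinear F → ∀ {u v w : Vector Carrier n} a (T : Matrix m n) →
                   (∀ k → u k ≈ a * v k + w k) → F (u ∷ T) ≈ a * F (v ∷ T) + F (w ∷ T)
      headLinear lin a T e = lin zero _ _ _ a
        (λ { zero z≢z → ⊥-elim (z≢z ≡.refl) ; (suc r) _ k → refl })
        (λ { zero z≢z → ⊥-elim (z≢z ≡.refl) ; (suc r) _ k → refl })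
        e

    multilinear-head-0 : Multilinear F → ∀ (T : Matrix m n) → F ((λ _ → 0#) ∷ T) ≈ 0#
    multilinear-head-0 lin T = x+x≈x⇒x≈0 _ (sym (trans
      (headLinear lin 1# T (λ k → sym (trans (+-congʳ (zeroʳ 1#)) (+-identityˡ 0#))))
      (+-congʳ (*-identityˡ _))))

    multilinear-head-+ : Multilinear F → ∀ (u v : Vector Carrier n) (T : Matrix m n) →
                         F ((λ k → u k + v k) ∷ T) ≈ F (u ∷ T) + F (v ∷ T)
    multilinear-head-+ lin u v T =
      trans (headLinear lin 1# T (λ k → +-congʳ (sym (*-identityˡ _)))) (+-congʳ (*-identityˡ _))

    multilinear-head-* : Multilinear F → ∀ (a : Carrier) (u : Vector Carrier n) (T : Matrix m n) →
                         F ((λ k → a * u k) ∷ T) ≈ a * F (u ∷ T)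
    multilinear-head-* lin a u T =
      trans (headLinear lin a T (λ k → sym (+-identityʳ _)))
            (trans (+-congˡ (multilinear-head-0 lin T)) (+-identityʳ _))

    multilinear-head-∑ : Multilinear F → ∀ {p} (g : Fin p → Vector Carrier n) (T : Matrix m n) →
                         F ((λ k → ∑ (λ j → g j k)) ∷ T) ≈ ∑ (λ j → F (g j ∷ T))
    multilinear-head-∑ lin {zero} g T = multilinear-head-0 lin T
    multilinear-head-∑ lin {suc p} g T =
      trans (multilinear-head-+ lin (g zero) (λ k → ∑ (λ j → g (suc j) k)) T)
            (+-congˡ (multilinear-head-∑ lin (λ j → g (suc j)) T))

  fixHead-alternating : ∀ {m n} {F : Matrix (suc (suc m)) n → Carrier} →
                        Alternating F → (u : Vector Carrier n) → Alternating (λ T → F (u ∷ T))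
  fixHead-alternating alt u i A = alt (suc i) (u ∷ A)

  -- Polarisation: expand F ((u + v) ∷ (u + v) ∷ T) = 0 by linearity in both rows.
  alternating-swap : ∀ {m n} {F : Matrix (suc (suc m)) n → Carrier} →
    Multilinear F → Alternating F → ∀ (u v : Vector Carrier n) (T : Matrix m n) →
    F (u ∷ v ∷ T) ≈ - F (v ∷ u ∷ T)
  alternating-swap {n = n} {F = F} lin alt u v T =
    +-inverseʳ-unique _ _ (trans (+-comm _ _) (sym (begin
      0#                                     ≈⟨ alt zero (w ∷ w ∷ T) (λ k → refl) ⟨
      F (w ∷ w ∷ T)                          ≈⟨ multilinear-head-+ lin u v (w ∷ T) ⟩
      F (u ∷ w ∷ T) + F (v ∷ w ∷ T)          ≈⟨ +-cong (multilinear-head-+ (fixHead-multilinear lin u) u v T)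
                                                       (multilinear-head-+ (fixHead-multilinear lin v) u v T) ⟩
      (F (u ∷ u ∷ T) + F (u ∷ v ∷ T)) + (F (v ∷ u ∷ T) + F (v ∷ v ∷ T))
                                             ≈⟨ +-cong (+-congʳ (alt zero (u ∷ u ∷ T) (λ k → refl)))
                                                       (+-congˡ (alt zero (v ∷ v ∷ T) (λ k → refl))) ⟩
      (0# + F (u ∷ v ∷ T)) + (F (v ∷ u ∷ T) + 0#)
                                             ≈⟨ +-cong (+-identityˡ _) (+-identityʳ _) ⟩
      F (u ∷ v ∷ T) + F (v ∷ u ∷ T)          ∎)))
    where
    w : Vector Carrier n
    w k = u k + v k

  alternating-head≋ : ∀ {m n} {F : Matrix (suc m) n → Carrier} → Extensional F → Multilinear F → Alternating F →
                      ∀ (i : Fin m) (A : Matrix (suc m) n) → A zero ≋ A (suc i) → F A ≈ 0#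
  alternating-head≋ ext lin alt zero A A₀≋ = alt zero A A₀≋
  alternating-head≋ {suc m} {F = F} ext lin alt (suc i) A A₀≋ = begin
    F A                                ≈⟨ ext (λ { zero k → refl ; (suc zero) k → refl ; (suc (suc r)) k → refl }) ⟩
    F (A zero ∷ A (suc zero) ∷ rest)   ≈⟨ alternating-swap lin alt _ _ _ ⟩
    - F (A (suc zero) ∷ A zero ∷ rest) ≈⟨ -‿cong (alternating-head≋ (fixHead-extensional ext _) (fixHead-multilinear lin _)
                                                    (fixHead-alternating alt _) i (A zero ∷ rest) A₀≋) ⟩
    - 0#                               ≈⟨ -0#≈0# ⟩
    0#                                 ∎
    where rest = λ r → A (suc (suc r))

  toTop : ∀ {m n} → Fin (suc m) → Matrix (suc m) n → Matrix (suc m) n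
  toTop j A zero    = A j
  toTop j A (suc k) = A (punchIn j k)

  alternating-toTop : ∀ {m n} {F : Matrix (suc m) n → Carrier} → Extensional F → Multilinear F → Alternating F →
                      ∀ (j : Fin (suc m)) (A : Matrix (suc m) n) → F (toTop j A) ≈ sign (toℕ j) * F A
  alternating-toTop ext lin alt zero A = trans (ext (λ { zero k → refl ; (suc r) k → refl })) (sym (*-identityˡ _))
  alternating-toTop {suc m} {F = F} ext lin alt (suc j) A = begin
    F (toTop (suc j) A)                  ≈⟨ ext (λ { zero k → refl ; (suc zero) k → refl ; (suc (suc r)) k → refl }) ⟩
    F (A (suc j) ∷ A zero ∷ rest)        ≈⟨ alternating-swap lin alt _ _ _ ⟩
    - F (A zero ∷ A (suc j) ∷ rest)      ≈⟨ -‿cong (fixHead-extensional ext (A zero) (λ { zero k → refl ; (suc r) k → refl })) ⟩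
    - F (A zero ∷ toTop j (tail A))      ≈⟨ -‿cong (alternating-toTop (fixHead-extensional ext _) (fixHead-multilinear lin _)
                                                      (fixHead-alternating alt _) j (tail A)) ⟩
    - (sign (toℕ j) * F (A zero ∷ tail A)) ≈⟨ -‿cong (*-congˡ (ext (λ { zero k → refl ; (suc r) k → refl }))) ⟩
    - (sign (toℕ j) * F A)               ≈⟨ -‿distribˡ-* _ _ ⟩
    (- sign (toℕ j)) * F A               ∎
    where rest = λ k → A (suc (punchIn j k))

  multilinear-subtractRow : ∀ {m n} (Φ : Matrix m n → Carrier) → Extensional Φ → Multilinear Φ →
    (u : Vector Carrier n) → (∀ (T : Matrix m n) i → T i ≋ u → Φ T ≈ 0#) →
    (cs : Vector Carrier m) (T : Matrix m n) → Φ (λ r k → T r k - cs r * u k) ≈ Φ T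
  multilinear-subtractRow {zero} Φ ext lin u vanish cs T = ext (λ ())
  multilinear-subtractRow {suc m} {n} Φ ext lin u vanish cs T = begin
    Φ T'                          ≈⟨ ext (λ { zero k → refl ; (suc r) k → refl }) ⟩
    Φ (x ∷ tail T')               ≈⟨ multilinear-subtractRow (λ S → Φ (x ∷ S)) (fixHead-extensional ext x) (fixHead-multilinear lin x) u
                                       (λ S i Sᵢ≋u → vanish (x ∷ S) (suc i) Sᵢ≋u) (tail cs) (tail T) ⟩
    Φ (x ∷ tail T)                ≈⟨ lin zero (x ∷ tail T) (u ∷ tail T) T (- cs zero)
                                       (λ { zero z≢z → ⊥-elim (z≢z ≡.refl) ; (suc r) _ k → refl })
                                       (λ { zero z≢z → ⊥-elim (z≢z ≡.refl) ; (suc r) _ k → refl })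
                                       (λ k → trans (+-comm _ _) (+-congʳ (-‿distribˡ-* _ _))) ⟩
    (- cs zero) * Φ (u ∷ tail T) + Φ T ≈⟨ +-congʳ (trans (*-congˡ (vanish (u ∷ tail T) zero (λ k → refl))) (zeroʳ _)) ⟩
    0# + Φ T                      ≈⟨ +-identityˡ _ ⟩
    Φ T                           ∎
    where
    T' : Matrix (suc m) n
    T' r k = T r k - cs r * u k
    x : Vector Carrier n
    x = T' zero

  identity : ∀ {n} → Matrix n n
  identity = δ

  insertZero : ∀ {n} → Fin (suc n) → Vector Carrier n → Vector Carrier (suc n)
  insertZero j v k with j Fin.≟ k
  ... | yes _   = 0#
  ... | no j≢k = v (punchOut j≢k)

  insertZero-cong : ∀ {n} (j : Fin (suc n)) {v w : Vector Carrier n} → v ≋ w → insertZero j v ≋ insertZero j w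
  insertZero-cong j e k with j Fin.≟ k
  ... | yes _   = refl
  ... | no j≢k = e (punchOut j≢k)

  insertZero-linear : ∀ {n} (j : Fin (suc n)) a (v w z : Vector Carrier n) → (∀ k → v k ≈ a * w k + z k) →
                      ∀ k → insertZero j v k ≈ a * insertZero j w k + insertZero j z k
  insertZero-linear j a v w z e k with j Fin.≟ k
  ... | yes _   = sym (trans (+-congʳ (zeroʳ a)) (+-identityˡ 0#))
  ... | no j≢k = e (punchOut j≢k)

  insertZero-clearColumn : ∀ {n} (j : Fin (suc n)) (v : Vector Carrier (suc n)) k →
                           v k - v j * δ j k ≈ insertZero j (λ l → v (punchIn j l)) k
  insertZero-clearColumn j v k with j Fin.≟ k
  ... | yes ≡.refl = trans (+-congˡ (-‿cong (trans (*-congˡ (δ-refl j)) (*-identityʳ _)))) (-‿inverseʳ _)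
  ... | no j≢k    = trans (+-congˡ (trans (-‿cong (trans (*-congˡ (δ-≢ j≢k)) (zeroʳ _))) -0#≈0#))
                          (trans (+-identityʳ _) (reflexive (≡.cong v (≡.sym (punchIn-punchOut j≢k)))))

  insertZero-δ : ∀ {n} (j : Fin (suc n)) (r : Fin n) k → insertZero j (δ r) k ≈ δ (punchIn j r) k
  insertZero-δ j r k with j Fin.≟ k
  ... | yes ≡.refl = sym (δ-≢ (punchInᵢ≢i j r))
  ... | no j≢k    = reflexive (≡.sym (≡.trans (≡.cong (δ (punchIn j r)) (≡.sym (punchIn-punchOut j≢k)))
                                                 (δ-punchIn j r (punchOut j≢k))))

  AlternatingSquare : ∀ {n} → (Matrix n n → Carrier) → Set (c ⊔ ℓ)
  AlternatingSquare {zero}  F = ⊤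
  AlternatingSquare {suc n} F = Alternating F

  -- Expand the first row in the standard basis; in the j-th summand clear column j of
  -- the remaining rows, so that what is left is an alternating multilinear function of
  -- the j-th minor, to which induction applies.
  det-universal : ∀ {n} (F : Matrix n n → Carrier) → Extensional F → Multilinear F → AlternatingSquare F →
                  ∀ A → F A ≈ det A * F identity
  det-universal {zero} F ext lin alt A = trans (ext (λ ())) (sym (*-identityˡ _))
  det-universal {suc n} F ext lin alt A = begin
    F A                                              ≈⟨ ext (λ { zero k → sym (∑-*δʳ (A zero) k) ; (suc r) k → refl }) ⟩
    F ((λ k → ∑ (λ j → A zero j * δ j k)) ∷ tail A)  ≈⟨ multilinear-head-∑ lin (λ j k → A zero j * δ j k) (tail A) ⟩
    ∑ (λ j → F ((λ k → A zero j * δ j k) ∷ tail A))  ≈⟨ ∑-cong summand ⟩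
    ∑ (λ j → laplaceTerm A j * F identity)           ≈⟨ *-distribʳ-∑ (F identity) (laplaceTerm A) ⟨
    det A * F identity                               ∎
    where
    Fⱼ : Fin (suc n) → Matrix n n → Carrier
    Fⱼ j N = F (δ j ∷ (λ r → insertZero j (N r)))
    Fⱼ-alternating : ∀ {n'} (j : Fin (suc n')) (F' : Matrix (suc n') (suc n') → Carrier) → Alternating F' →
                     AlternatingSquare (λ (N : Matrix n' n') → F' (δ j ∷ (λ r → insertZero j (N r))))
    Fⱼ-alternating {zero}   j F' alt' = _
    Fⱼ-alternating {suc n'} j F' alt' i N Nᵢ≋ = alt' (suc i) _ (insertZero-cong j Nᵢ≋)
    summand : ∀ j → F ((λ k → A zero j * δ j k) ∷ tail A) ≈ laplaceTerm A j * F identity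
    summand j = begin
      F ((λ k → A zero j * δ j k) ∷ tail A)
        ≈⟨ multilinear-head-* lin (A zero j) (δ j) (tail A) ⟩
      A zero j * F (δ j ∷ tail A)
        ≈⟨ *-congˡ (multilinear-subtractRow (λ S → F (δ j ∷ S)) (fixHead-extensional ext (δ j)) (fixHead-multilinear lin (δ j)) (δ j)
                      (λ S i Sᵢ≋δⱼ → alternating-head≋ ext lin alt i (δ j ∷ S) (λ k → sym (Sᵢ≋δⱼ k))) (λ r → A (suc r) j) (tail A)) ⟨
      A zero j * F (δ j ∷ (λ r k → A (suc r) k - A (suc r) j * δ j k))
        ≈⟨ *-congˡ (ext (λ { zero k → refl ; (suc r) k → insertZero-clearColumn j (A (suc r)) k })) ⟩
      A zero j * Fⱼ j (minor j A)
        ≈⟨ *-congˡ (det-universal (Fⱼ j)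
                      (λ e → ext (λ { zero k → refl ; (suc r) k → insertZero-cong j (e r) k }))
                      (λ i A' B C a A≋B A≋C Aᵢ≈ → lin (suc i) _ _ _ a
                          (λ { zero _ k → refl ; (suc r) r≢ k → insertZero-cong j (A≋B r (λ e → r≢ (≡.cong suc e))) k })
                          (λ { zero _ k → refl ; (suc r) r≢ k → insertZero-cong j (A≋C r (λ e → r≢ (≡.cong suc e))) k })
                          (insertZero-linear j a (A' i) (B i) (C i) Aᵢ≈))
                      (Fⱼ-alternating j F alt) (minor j A)) ⟩
      A zero j * (det (minor j A) * Fⱼ j identity)
        ≈⟨ *-congˡ (*-congˡ (ext (λ { zero k → refl ; (suc r) k → insertZero-δ j r k }))) ⟩
      A zero j * (det (minor j A) * F (toTop j identity))
        ≈⟨ *-congˡ (*-congˡ (alternating-toTop ext lin alt j identity)) ⟩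
      A zero j * (det (minor j A) * (sign (toℕ j) * F identity))
        ≈⟨ solve 4 (λ a d s f → a :* (d :* (s :* f)) := (s :* (a :* d)) :* f) refl _ _ _ _ ⟩
      laplaceTerm A j * F identity ∎

  _*ᴹ_ : ∀ {n} → Matrix n n → Matrix n n → Matrix n n
  (A *ᴹ B) i k = ∑ (λ l → A i l * B l k)

  det-*ᴹ : ∀ {n} (A B : Matrix n n) → det (A *ᴹ B) ≈ det A * det B
  det-*ᴹ {n} A B = trans (det-universal (λ X → det (X *ᴹ B)) ext lin (alt {n}) A)
                         (*-congˡ (det-cong (λ i k → ∑-δ*ˡ (λ l → B l k) i)))
    where
    ext : Extensional (λ X → det (X *ᴹ B))
    ext e = det-cong (λ r k → ∑-cong (λ l → *-congʳ (e r l)))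
    lin : Multilinear (λ X → det (X *ᴹ B))
    lin i A' B' C a A≋B A≋C Aᵢ≈ =
      det-multilinear i (A' *ᴹ B) (B' *ᴹ B) (C *ᴹ B) a
        (λ r r≢ k → ∑-cong (λ l → *-congʳ {B l k} (A≋B r r≢ l)))
        (λ r r≢ k → ∑-cong (λ l → *-congʳ {B l k} (A≋C r r≢ l)))
        (λ k → begin
          ∑ (λ l → A' i l * B l k)
            ≈⟨ ∑-cong (λ l → trans (*-congʳ (Aᵢ≈ l))
                 (solve 4 (λ a x y b → (a :* x :+ y) :* b := a :* (x :* b) :+ y :* b) refl a (B' i l) (C i l) (B l k))) ⟩
          ∑ (λ l → a * (B' i l * B l k) + C i l * B l k)
            ≈⟨ ∑-+ (λ l → a * (B' i l * B l k)) (λ l → C i l * B l k) ⟩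
          ∑ (λ l → a * (B' i l * B l k)) + ∑ (λ l → C i l * B l k)
            ≈⟨ +-congʳ (*-distribˡ-∑ a (λ l → B' i l * B l k)) ⟨
          a * ∑ (λ l → B' i l * B l k) + ∑ (λ l → C i l * B l k) ∎)
    alt : ∀ {n'} {B' : Matrix n' n'} → AlternatingSquare {n'} (λ X → det (X *ᴹ B'))
    alt {zero} = _
    alt {suc n'} {B'} i X Xᵢ≋ = det-alternating i (X *ᴹ B') (λ k → ∑-cong (λ l → *-congʳ {B' l k} (Xᵢ≋ l)))

  diagonal : ∀ {n} → Vector Carrier n → Matrix n n
  diagonal d i j = δ i j * d i

  det-diagonal : ∀ {n} (d : Vector Carrier n) → det (diagonal d) ≈ ∏ d
  det-diagonal {zero} d = refl
  det-diagonal {suc n} d = begin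
    laplaceTerm (diagonal d) zero + ∑ (λ j → laplaceTerm (diagonal d) (suc j))
      ≈⟨ +-cong (trans (*-identityˡ _) (*-cong (*-identityˡ _) (det-diagonal (tail d))))
                (∑-≈0 {f = λ j → laplaceTerm (diagonal d) (suc j)}
                      (λ j → trans (*-congˡ (trans (*-congʳ (zeroˡ _)) (zeroˡ _))) (zeroʳ _))) ⟩
    d zero * ∏ (tail d) + 0# ≈⟨ +-identityʳ _ ⟩
    ∏ d ∎

  det-scaleRows : ∀ {n} (cs : Vector Carrier n) (N : Matrix n n) → det (λ i k → cs i * N i k) ≈ ∏ cs * det N
  det-scaleRows {n} cs N = begin
    det (λ i k → cs i * N i k) ≈⟨ det-cong (λ i k → trans (∑-cong {n} (λ l → *-assoc _ _ _)) (∑-δ*ˡ (λ l → cs i * N l k) i)) ⟨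
    det (diagonal cs *ᴹ N)     ≈⟨ det-*ᴹ (diagonal cs) N ⟩
    det (diagonal cs) * det N  ≈⟨ *-congʳ (det-diagonal cs) ⟩
    ∏ cs * det N               ∎

  pow≡^ : ∀ x k → pow x k ≡ x ^ k
  pow≡^ x zero    = ≡.refl
  pow≡^ x (suc k) = ≡.cong (x *_) (pow≡^ x k)

  pow-+ : ∀ x a b → pow x (a ℕ.+ b) ≈ pow x a * pow x b
  pow-+ x a b = begin
    pow x (a ℕ.+ b)   ≡⟨ pow≡^ x (a ℕ.+ b) ⟩
    x ^ (a ℕ.+ b)     ≈⟨ ^-homo-* x a b ⟩
    x ^ a * x ^ b     ≡⟨ ≡.cong₂ _*_ (pow≡^ x a) (pow≡^ x b) ⟨
    pow x a * pow x b ∎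

  pow-* : ∀ x a b → pow x (a ℕ.* b) ≈ pow (pow x a) b
  pow-* x a b = begin
    pow x (a ℕ.* b)   ≡⟨ pow≡^ x (a ℕ.* b) ⟩
    x ^ (a ℕ.* b)     ≈⟨ ^-assocʳ x a b ⟨
    (x ^ a) ^ b       ≡⟨ ≡.cong (_^ b) (pow≡^ x a) ⟨
    (pow x a) ^ b     ≡⟨ pow≡^ (pow x a) b ⟨
    pow (pow x a) b   ∎

  module FieldTheory (isField : IsField) where

    *-cancelˡ-≉0 : ∀ {a b d} → a ≉ 0# → a * b ≈ a * d → b ≈ d
    *-cancelˡ-≉0 {a} {b} {d} a≉0 e =
      let a⁻¹ , aa⁻¹≈1 = proj₂ isField a a≉0
          cancel : ∀ x → a⁻¹ * (a * x) ≈ x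
          cancel x = trans (sym (*-assoc _ _ _)) (trans (*-congʳ (trans (*-comm _ _) aa⁻¹≈1)) (*-identityˡ x))
      in trans (sym (cancel b)) (trans (*-congˡ e) (cancel d))

    *-≉0 : ∀ {a b} → a ≉ 0# → b ≉ 0# → a * b ≉ 0#
    *-≉0 a≉0 b≉0 ab≈0 = b≉0 (*-cancelˡ-≉0 a≉0 (trans ab≈0 (sym (zeroʳ _))))

    ∏-≉0 : ∀ {m} (f : Vector Carrier m) → (∀ i → f i ≉ 0#) → ∏ f ≉ 0#
    ∏-≉0 {zero}  f f≉0 = proj₁ isField
    ∏-≉0 {suc m} f f≉0 = *-≉0 (f≉0 zero) (∏-≉0 (tail f) (λ i → f≉0 (suc i)))

    vandermonde : ∀ {n} → Vector Carrier n → Matrix n n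
    vandermonde x i j = pow (x i) (toℕ j)

    -- Subtracting x₀ times each column from the next one turns the first row into
    -- (1, 0, …, 0) and row i into (1, (xᵢ - x₀) xᵢ⁰, …, (xᵢ - x₀) xᵢⁿ⁻¹).
    vandermonde-columnOps : ∀ {n} (x : Vector Carrier (suc n)) → Matrix (suc n) (suc n)
    vandermonde-columnOps x j zero    = δ j zero
    vandermonde-columnOps x j (suc k) = δ j (suc k) - x zero * δ j (inject₁ k)

    vandermonde-*-columnOps : ∀ {n} (x : Vector Carrier (suc n)) i k →
      (vandermonde x *ᴹ vandermonde-columnOps x) i (suc k) ≈ (x i - x zero) * pow (x i) (toℕ k)
    vandermonde-*-columnOps {n} x i k = begin
      ∑ (λ l → V l * (δ l (suc k) - x₀ * δ l (inject₁ k)))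
        ≈⟨ ∑-cong (λ l → trans (distribˡ (V l) (δ l (suc k)) _) (+-congˡ (trans (sym (-‿distribʳ-* (V l) _))
             (-‿cong (solve 3 (λ a b d → a :* (b :* d) := b :* (a :* d)) refl (V l) x₀ (δ l (inject₁ k))))))) ⟩
      ∑ (λ l → V l * δ l (suc k) + - (x₀ * (V l * δ l (inject₁ k))))
        ≈⟨ ∑-+ (λ l → V l * δ l (suc k)) (λ l → - (x₀ * (V l * δ l (inject₁ k)))) ⟩
      ∑ (λ l → V l * δ l (suc k)) + ∑ (λ l → - (x₀ * (V l * δ l (inject₁ k))))
        ≈⟨ +-cong (∑-*δʳ V (suc k))
                  (trans (-‿distrib-∑ (λ l → x₀ * (V l * δ l (inject₁ k))))
                         (-‿cong (trans (sym (*-distribˡ-∑ x₀ (λ l → V l * δ l (inject₁ k)))) (*-congˡ (∑-*δʳ V (inject₁ k)))))) ⟩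
      x i * pow (x i) (toℕ k) + - (x₀ * pow (x i) (toℕ (inject₁ k)))
        ≡⟨ ≡.cong (λ e → x i * pow (x i) (toℕ k) + - (x₀ * pow (x i) e)) (toℕ-inject₁ k) ⟩
      x i * pow (x i) (toℕ k) + - (x₀ * pow (x i) (toℕ k))
        ≈⟨ +-congˡ (-‿distribˡ-* _ _) ⟩
      x i * pow (x i) (toℕ k) + (- x₀) * pow (x i) (toℕ k)
        ≈⟨ distribʳ _ _ _ ⟨
      (x i - x₀) * pow (x i) (toℕ k) ∎
      where
      x₀ = x zero
      V = vandermonde x i

    det-vandermonde-≉0 : ∀ {n} (x : Vector Carrier n) → (∀ i j → x i ≈ x j → i ≡ j) → det (vandermonde x) ≉ 0#
    det-vandermonde-≉0 {zero}  x x-injective = proj₁ isField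
    det-vandermonde-≉0 {suc n} x x-injective detV≈0 =
      *-≉0 (∏-≉0 cs cs≉0) (det-vandermonde-≉0 (tail x) tail-injective) (begin
        ∏ cs * det (vandermonde (tail x)) ≈⟨ reduced ⟨
        det W                             ≈⟨ det-*ᴹ (vandermonde x) U ⟩
        det (vandermonde x) * det U       ≈⟨ *-congʳ detV≈0 ⟩
        0# * det U                        ≈⟨ zeroˡ _ ⟩
        0#                                ∎)
      where
      U = vandermonde-columnOps x
      W = vandermonde x *ᴹ U
      cs : Vector Carrier n
      cs i = x (suc i) - x zero
      cs≉0 : ∀ i → cs i ≉ 0#
      cs≉0 i cᵢ≈0 with x-injective (suc i) zero (x∙y⁻¹≈ε⇒x≈y _ _ cᵢ≈0)
      ... | ()
      tail-injective : ∀ i j → tail x i ≈ tail x j → i ≡ j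
      tail-injective i j e = suc-injective (x-injective (suc i) (suc j) e)
      reduced : det W ≈ ∏ cs * det (vandermonde (tail x))
      reduced = begin
        laplaceTerm W zero + ∑ (λ j → laplaceTerm W (suc j))
          ≈⟨ +-cong (trans (*-identityˡ _) (*-congʳ (∑-*δʳ (vandermonde x zero) zero)))
                    (∑-≈0 {f = λ j → laplaceTerm W (suc j)} λ j → trans (*-congˡ (trans (*-congʳ
                        (trans (vandermonde-*-columnOps x zero j) (trans (*-congʳ (-‿inverseʳ (x zero))) (zeroˡ _))))
                        (zeroˡ _))) (zeroʳ _)) ⟩
        1# * det (minor zero W) + 0#                  ≈⟨ trans (+-identityʳ _) (*-identityˡ _) ⟩
        det (minor zero W)                            ≈⟨ det-cong (λ i k → vandermonde-*-columnOps x (suc i) k) ⟩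
        det (λ i k → cs i * vandermonde (tail x) i k) ≈⟨ det-scaleRows cs (vandermonde (tail x)) ⟩
        ∏ cs * det (vandermonde (tail x))             ∎

    module _ {n : ℕ} {ω : Carrier} (ω-primitive : PrimitiveRoot n ω) where

      pow-≉0 : ∀ a → a ℕ.≤ n → pow ω a ≉ 0#
      pow-≉0 a a≤n ωᵃ≈0 = proj₁ isField (begin
        1#                            ≈⟨ proj₁ ω-primitive ⟨
        pow ω n                       ≡⟨ ≡.cong (pow ω) (m+[n∸m]≡n a≤n) ⟨
        pow ω (a ℕ.+ (n ℕ.∸ a))       ≈⟨ pow-+ ω a _ ⟩
        pow ω a * pow ω (n ℕ.∸ a)     ≈⟨ *-congʳ ωᵃ≈0 ⟩
        0# * pow ω (n ℕ.∸ a)          ≈⟨ zeroˡ _ ⟩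
        0#                            ∎)

      pow-<-≉ : ∀ {a b} → a ℕ.< b → b ℕ.< n → pow ω a ≉ pow ω b
      pow-<-≉ {a} {b} a<b b<n ωᵃ≈ωᵇ =
        proj₂ ω-primitive (b ℕ.∸ a) (m<n⇒0<n∸m a<b) (≤-<-trans (m∸n≤m b a) b<n)
          (sym (*-cancelˡ-≉0 (pow-≉0 a (<⇒≤ (<-trans a<b b<n))) (begin
            pow ω a * 1#                ≈⟨ *-identityʳ _ ⟩
            pow ω a                     ≈⟨ ωᵃ≈ωᵇ ⟩
            pow ω b                     ≡⟨ ≡.cong (pow ω) (m+[n∸m]≡n (<⇒≤ a<b)) ⟨
            pow ω (a ℕ.+ (b ℕ.∸ a))     ≈⟨ pow-+ ω a _ ⟩
            pow ω a * pow ω (b ℕ.∸ a)   ∎)))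

      pow-injective : ∀ (i j : Fin n) → pow ω (toℕ i) ≈ pow ω (toℕ j) → i ≡ j
      pow-injective i j e with <-cmp (toℕ i) (toℕ j)
      ... | tri< i<j _ _ = ⊥-elim (pow-<-≉ i<j (toℕ<n j) e)
      ... | tri≈ _ i≡j _ = toℕ-injective i≡j
      ... | tri> _ _ j<i = ⊥-elim (pow-<-≉ j<i (toℕ<n i) (sym e))

      fourier : Matrix n n
      fourier i r = pow ω (toℕ i ℕ.* toℕ r)

      -- M F = F Λ with F invertible (a Vandermonde matrix in the distinct powers of ω).
      det-fourierEigenbasis : ∀ (M : Matrix n n) (μ : Vector Carrier n) →
        (∀ i r → (M *ᴹ fourier) i r ≈ fourier i r * μ r) → det M ≈ ∏ μ
      det-fourierEigenbasis M μ eigen = *-cancelˡ-≉0 detF≉0 (begin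
        det fourier * det M                ≈⟨ *-comm _ _ ⟩
        det M * det fourier                ≈⟨ det-*ᴹ M fourier ⟨
        det (M *ᴹ fourier)                 ≈⟨ det-cong (λ i r → trans (eigen i r) (sym (fourier-*-diagonal i r))) ⟩
        det (fourier *ᴹ diagonal μ)        ≈⟨ det-*ᴹ fourier (diagonal μ) ⟩
        det fourier * det (diagonal μ)     ≈⟨ *-congˡ (det-diagonal μ) ⟩
        det fourier * ∏ μ                  ∎)
        where
        detF≉0 : det fourier ≉ 0#
        detF≉0 = det-vandermonde-≉0 (λ i → pow ω (toℕ i)) pow-injective
                 ∘ trans (det-cong {n} (λ i r → sym (pow-* ω (toℕ i) (toℕ r))))
        fourier-*-diagonal : ∀ i r → (fourier *ᴹ diagonal μ) i r ≈ fourier i r * μ r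
        fourier-*-diagonal i r = trans (∑-cong {n} (λ l → trans (*-congˡ (*-comm _ _)) (sym (*-assoc _ _ _))))
                                       (∑-*δʳ (λ l → fourier i l * μ l) r)

module FiniteSums {c ℓ : Level} (R : CommutativeRing c ℓ) where

  open import Data.Nat as ℕ using (ℕ; zero; suc; z≤n; s≤s; _≟_; _≤?_)
  open import Data.Nat.Properties as ℕ using (≤∧≢⇒<; <-irrefl; n<1+n)
  open import Data.Nat.GCD using (gcd; gcd[m,n]∣m; gcd-greatest; c*gcd[m,n]≡gcd[cm,cn])
  open import Data.Nat.Divisibility using (_∣_; divides; 0∣⇒≡0; ∣⇒≤; ∣m+n∣m⇒∣n; n∣m*n; ∣-antisym; ∣-refl)
  open import Data.Nat.DivMod using (_/_; m*n/n≡m)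
  open import Data.Fin using (Fin; toℕ)
  open import Data.List using (List; []; _∷_)
  open import Data.List.Membership.Propositional using (_∈_; _∉_)
  open import Data.List.Relation.Unary.Any using (here; there)
  open import Data.List.Relation.Unary.All using (lookup)
  open import Data.List.Relation.Unary.AllPairs using (_∷_)
  open import Data.List.Relation.Unary.Unique.Propositional using (Unique)
  open import Data.List.Relation.Unary.Unique.Propositional.Properties using (Unique[x∷xs]⇒x∉xs)
  open import Data.Product using (_×_; _,_)
  open import Data.Bool using (if_then_else_)
  open import Relation.Nullary using (Dec; yes; no; does; ¬_)
  open import Relation.Nullary.Decidable using (_×-dec_)
  open import Relation.Binary.PropositionalEquality as ≡ using (_≡_)
  open import Data.Empty using (⊥-elim)
  open import Defs using (module RingDefs; _/′_)

  open CommutativeRing R hiding (zero)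
  open RingDefs R
  open Determinants R
  open import Relation.Binary.Reasoning.Setoid setoid

  sumTo : ℕ → (ℕ → Carrier) → Carrier
  sumTo m h = ∑ {m} (λ i → h (toℕ i))

  sumTo-cong : ∀ m {h h' : ℕ → Carrier} → (∀ j → j ℕ.< m → h j ≈ h' j) → sumTo m h ≈ sumTo m h'
  sumTo-cong zero    e = refl
  sumTo-cong (suc m) e = +-cong (e 0 (s≤s z≤n)) (sumTo-cong m (λ j j<m → e (suc j) (s≤s j<m)))

  sumTo-≈0 : ∀ m {h : ℕ → Carrier} → (∀ j → j ℕ.< m → h j ≈ 0#) → sumTo m h ≈ 0#
  sumTo-≈0 m e = trans (sumTo-cong m e) (∑-≈0 {m} (λ _ → refl))

  sumTo-suc : ∀ m h → sumTo (suc m) h ≈ sumTo m h + h m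
  sumTo-suc zero    h = trans (+-identityʳ _) (sym (+-identityˡ _))
  sumTo-suc (suc m) h = trans (+-congˡ (sumTo-suc m (λ j → h (suc j)))) (sym (+-assoc _ _ _))

  sumTo-+ : ∀ a b h → sumTo (a ℕ.+ b) h ≈ sumTo a h + sumTo b (λ i → h (a ℕ.+ i))
  sumTo-+ zero    b h = sym (+-identityˡ _)
  sumTo-+ (suc a) b h = trans (+-congˡ (sumTo-+ a b (λ j → h (suc j)))) (sym (+-assoc _ _ _))

  sumTo-* : ∀ M d h → sumTo (M ℕ.* d) h ≈ sumTo M (λ a → sumTo d (λ e → h (a ℕ.* d ℕ.+ e)))
  sumTo-* zero    d h = refl
  sumTo-* (suc M) d h = trans (sumTo-+ d (M ℕ.* d) h)
    (+-congˡ (trans (sumTo-* M d (λ i → h (d ℕ.+ i)))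
      (sumTo-cong M (λ a _ → sumTo-cong d (λ e _ → reflexive (≡.cong h (≡.sym (ℕ.+-assoc d (a ℕ.* d) e))))))))

  𝟙 : ∀ {p} {P : Set p} → Dec P → Carrier
  𝟙 P? = if does P? then 1# else 0#

  𝟙-yes : ∀ {p} {P : Set p} (P? : Dec P) → P → 𝟙 P? ≈ 1#
  𝟙-yes (yes _) _  = refl
  𝟙-yes (no ¬p) p = ⊥-elim (¬p p)

  𝟙-no : ∀ {p} {P : Set p} (P? : Dec P) → ¬ P → 𝟙 P? ≈ 0#
  𝟙-no (yes p) ¬p = ⊥-elim (¬p p)
  𝟙-no (no _)  _  = refl

  sumL-cong : ∀ (xs : List ℕ) {g h : ℕ → Carrier} → (∀ d → d ∈ xs → g d ≈ h d) → sumL xs g ≈ sumL xs h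
  sumL-cong []       e = refl
  sumL-cong (x ∷ xs) e = +-cong (e x (here ≡.refl)) (sumL-cong xs (λ d d∈ → e d (there d∈)))

  sumL-≈0 : ∀ (xs : List ℕ) {g : ℕ → Carrier} → (∀ d → d ∈ xs → g d ≈ 0#) → sumL xs g ≈ 0#
  sumL-≈0 []       e = refl
  sumL-≈0 (x ∷ xs) e = trans (+-cong (e x (here ≡.refl)) (sumL-≈0 xs (λ d d∈ → e d (there d∈)))) (+-identityˡ 0#)

  *-distribʳ-sumL : ∀ (xs : List ℕ) (g : ℕ → Carrier) w → sumL xs g * w ≈ sumL xs (λ d → g d * w)
  *-distribʳ-sumL []       g w = zeroˡ w
  *-distribʳ-sumL (x ∷ xs) g w = trans (distribʳ w _ _) (+-congˡ (*-distribʳ-sumL xs g w))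

  sumTo-sumL : ∀ (xs : List ℕ) m (F : ℕ → ℕ → Carrier) →
               sumTo m (λ k → sumL xs (λ d → F d k)) ≈ sumL xs (λ d → sumTo m (F d))
  sumTo-sumL []       m F = sumTo-≈0 m (λ _ _ → refl)
  sumTo-sumL (x ∷ xs) m F =
    trans (∑-+ {m} (λ k → F x (toℕ k)) (λ k → sumL xs (λ d → F d (toℕ k)))) (+-congˡ (sumTo-sumL xs m F))

  sumL-𝟙-∉ : ∀ {g} (xs : List ℕ) → g ∉ xs → sumL xs (λ d → 𝟙 (g ≟ d)) ≈ 0#
  sumL-𝟙-∉ {g} xs g∉ = sumL-≈0 xs (λ d d∈ → 𝟙-no (g ≟ d) (λ { ≡.refl → g∉ d∈ }))

  sumL-𝟙-∈ : ∀ {g} {xs : List ℕ} → Unique xs → g ∈ xs → sumL xs (λ d → 𝟙 (g ≟ d)) ≈ 1#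
  sumL-𝟙-∈ {g} {x ∷ xs} unique (here ≡.refl) =
    trans (+-cong (𝟙-yes (g ≟ g) ≡.refl) (sumL-𝟙-∉ xs (Unique[x∷xs]⇒x∉xs unique))) (+-identityʳ 1#)
  sumL-𝟙-∈ {g} {x ∷ xs} (x∉ ∷ unique) (there g∈) =
    trans (+-cong (𝟙-no (g ≟ x) (λ g≡x → lookup x∉ g∈ (≡.sym g≡x))) (sumL-𝟙-∈ unique g∈)) (+-identityˡ 1#)

  nat-≈-sumTo : ∀ m x → x ℕ.≤ m → nat x ≈ sumTo m (λ q → nat (suc q) * 𝟙 (x ≟ suc q))
  nat-≈-sumTo zero    zero _   = refl
  nat-≈-sumTo (suc m) x    x≤m with x ≟ suc m
  ... | yes ≡.refl = sym (begin
    sumTo (suc m) t                                     ≈⟨ sumTo-suc m t ⟩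
    sumTo m t + nat (suc m) * 𝟙 (suc m ≟ suc m)         ≈⟨ +-cong (sumTo-≈0 m (λ j j<m →
                                                              trans (*-congˡ (𝟙-no (suc m ≟ suc j) (λ e → <-irrefl (≡.sym e) (s≤s j<m)))) (zeroʳ (nat (suc j)))))
                                                            (trans (*-congˡ (𝟙-yes (suc m ≟ suc m) ≡.refl)) (*-identityʳ _)) ⟩
    0# + nat (suc m)                                    ≈⟨ +-identityˡ _ ⟩
    nat (suc m)                                         ∎)
    where t = λ q → nat (suc q) * 𝟙 (suc m ≟ suc q)
  ... | no x≢ = begin
    nat x                                   ≈⟨ nat-≈-sumTo m x (ℕ.s≤s⁻¹ (≤∧≢⇒< x≤m x≢)) ⟩
    sumTo m t                               ≈⟨ +-identityʳ _ ⟨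
    sumTo m t + 0#                          ≈⟨ +-congˡ (trans (*-congˡ (𝟙-no (x ≟ suc m) x≢)) (zeroʳ (nat (suc m)))) ⟨
    sumTo m t + t m                         ≈⟨ sumTo-suc m t ⟨
    sumTo (suc m) t                         ∎
    where t = λ q → nat (suc q) * 𝟙 (x ≟ suc q)

  𝟙-* : ∀ {p} {P : Set p} (P? : Dec P) x → 𝟙 P? * x ≈ (if does P? then x else 0#)
  𝟙-* (yes _) x = *-identityˡ x
  𝟙-* (no _)  x = zeroˡ x

  𝟙-cong : ∀ {p q} {P : Set p} {Q : Set q} (P? : Dec P) (Q? : Dec Q) → (P → Q) → (Q → P) → 𝟙 P? ≈ 𝟙 Q?
  𝟙-cong (yes _) (yes _) _ _ = refl
  𝟙-cong (yes p) (no ¬q) f _ = ⊥-elim (¬q (f p))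
  𝟙-cong (no ¬p) (yes q) _ g = ⊥-elim (¬p (g q))
  𝟙-cong (no _)  (no _)  _ _ = refl

  -- The summand a = 0 is excluded by 1 ≤ a and the summand a = M of c(r, M) by gcd M M = M ≠ 1.
  ramanujan-sumTo : ∀ ζ r M → 2 ℕ.≤ M →
    sumTo M (λ a → 𝟙 (1 ≤? a ×-dec gcd a M ≟ 1) * pow ζ (a ℕ.* r)) ≈ ramanujan ζ r M
  ramanujan-sumTo ζ r (suc M'@(suc _)) (s≤s (s≤s z≤n)) = begin
    t 0 + sumTo M' (λ a → t (suc a))             ≈⟨ +-cong (zeroˡ _) (sumTo-cong M' (λ a _ → 𝟙-* (gcd (suc a) M ≟ 1) (pow ζ (suc a ℕ.* r)))) ⟩
    0# + sumTo M' (λ a → t′ (suc a))             ≈⟨ trans (+-identityˡ _) (sym (+-identityʳ _)) ⟩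
    sumTo M' (λ a → t′ (suc a)) + 0#             ≡⟨ ≡.cong (sumTo M' (λ a → t′ (suc a)) +_) t′M≡0 ⟨
    sumTo M' (λ a → t′ (suc a)) + t′ (suc M')   ≈⟨ sumTo-suc M' (λ a → t′ (suc a)) ⟨
    ramanujan ζ r M                              ∎
    where
    M = suc M'
    t t′ : ℕ → Carrier
    t a = 𝟙 (1 ≤? a ×-dec gcd a M ≟ 1) * pow ζ (a ℕ.* r)
    t′ a = if does (gcd a M ≟ 1) then pow ζ (a ℕ.* r) else 0#
    gcd[M,M]≡M : gcd M M ≡ M
    gcd[M,M]≡M = ∣-antisym (gcd[m,n]∣m M M) (gcd-greatest ∣-refl ∣-refl)
    t′M≡0 : t′ M ≡ 0#
    t′M≡0 = ≡.cong (λ g → if does (g ≟ 1) then pow ζ (M ℕ.* r) else 0#) gcd[M,M]≡M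

  -- Writing k = a d + e, only the multiples k = a d of d have gcd k N = d, and for them
  -- gcd (a d) (M d) = d · gcd a M.
  ∑-G≈ramanujan : ∀ N d r ω → d ∣ N → d ℕ.< N →
    sumTo N (λ k → 𝟙 (1 ≤? k ×-dec gcd k N ≟ d) * pow ω (k ℕ.* r)) ≈ ramanujan (pow ω d) r (N /′ d)
  ∑-G≈ramanujan N zero r ω 0∣N 0<N = ⊥-elim (ℕ.<⇒≢ 0<N (≡.sym (0∣⇒≡0 0∣N)))
  ∑-G≈ramanujan N d@(suc d') r ω (divides M N≡Md) d<N = begin
    sumTo N h                                     ≡⟨ ≡.cong (λ z → sumTo z h) N≡Md ⟩
    sumTo (M ℕ.* d) h                             ≈⟨ sumTo-* M d h ⟩
    sumTo M (λ a → sumTo d (λ e → h (a ℕ.* d ℕ.+ e))) ≈⟨ sumTo-cong M (λ a _ → onlyMultiples a) ⟩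
    sumTo M (λ a → h (a ℕ.* d))                   ≈⟨ sumTo-cong M (λ a _ → *-cong (𝟙-cong (1 ≤? a ℕ.* d ×-dec gcd (a ℕ.* d) N ≟ d)
                                                         (1 ≤? a ×-dec gcd a M ≟ 1) (coprime-multiple a) (multiple-coprime a)) (pow-*d a)) ⟩
    sumTo M (λ a → 𝟙 (1 ≤? a ×-dec gcd a M ≟ 1) * pow ζ (a ℕ.* r)) ≈⟨ ramanujan-sumTo ζ r M 2≤M ⟩
    ramanujan ζ r M                               ≡⟨ ≡.cong (ramanujan ζ r) N/d≡M ⟨
    ramanujan ζ r (N /′ d)                        ∎
    where
    ζ = pow ω d
    h : ℕ → Carrier
    h k = 𝟙 (1 ≤? k ×-dec gcd k N ≟ d) * pow ω (k ℕ.* r)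
    N/d≡M : N /′ d ≡ M
    N/d≡M = ≡.trans (≡.cong (_/ d) N≡Md) (m*n/n≡m M d)
    2≤M : 2 ℕ.≤ M
    2≤M = ℕ.≰⇒> λ M≤1 → ℕ.<⇒≱ d<N
      (≡.subst (ℕ._≤ d) (≡.sym N≡Md) (ℕ.≤-trans (ℕ.*-monoˡ-≤ d M≤1) (ℕ.≤-reflexive (ℕ.*-identityˡ d))))
    gcd[ad,N]≡d*gcd[a,M] : ∀ a → gcd (a ℕ.* d) N ≡ d ℕ.* gcd a M
    gcd[ad,N]≡d*gcd[a,M] a = ≡.trans (≡.cong₂ gcd (ℕ.*-comm a d) (≡.trans N≡Md (ℕ.*-comm M d))) (≡.sym (c*gcd[m,n]≡gcd[cm,cn] d a M))
    coprime-multiple : ∀ a → 1 ℕ.≤ a ℕ.* d × gcd (a ℕ.* d) N ≡ d → 1 ℕ.≤ a × gcd a M ≡ 1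
    coprime-multiple a (1≤ad , g≡d) = ℕ.>-nonZero⁻¹ a {{ℕ.m*n≢0⇒m≢0 a {{ℕ.>-nonZero 1≤ad}}}} , ℕ.*-cancelˡ-≡ (gcd a M) 1 d (≡.trans (≡.sym (gcd[ad,N]≡d*gcd[a,M] a)) (≡.trans g≡d (≡.sym (ℕ.*-identityʳ d))))
    multiple-coprime : ∀ a → 1 ℕ.≤ a × gcd a M ≡ 1 → 1 ℕ.≤ a ℕ.* d × gcd (a ℕ.* d) N ≡ d
    multiple-coprime a (1≤a , g≡1) = ℕ.*-mono-≤ 1≤a (s≤s z≤n) , ≡.trans (gcd[ad,N]≡d*gcd[a,M] a) (≡.trans (≡.cong (d ℕ.*_) g≡1) (ℕ.*-identityʳ d))
    pow-*d : ∀ a → pow ω (a ℕ.* d ℕ.* r) ≈ pow ζ (a ℕ.* r)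
    pow-*d a = trans (reflexive (≡.cong (pow ω) (≡.trans (≡.cong (ℕ._* r) (ℕ.*-comm a d)) (ℕ.*-assoc d a r)))) (pow-* ω d (a ℕ.* r))
    onlyMultiples : ∀ a → sumTo d (λ e → h (a ℕ.* d ℕ.+ e)) ≈ h (a ℕ.* d)
    onlyMultiples a = trans (+-cong (reflexive (≡.cong h (ℕ.+-identityʳ (a ℕ.* d)))) (sumTo-≈0 d' offMultiple)) (+-identityʳ _)
      where
      offMultiple : ∀ e → e ℕ.< d' → h (a ℕ.* d ℕ.+ suc e) ≈ 0#
      offMultiple e e<d' = trans (*-congʳ (𝟙-no (1 ≤? k ×-dec gcd k N ≟ d) (λ (_ , g≡d) → <-irrefl ≡.refl
          (ℕ.<-≤-trans (s≤s e<d') (∣⇒≤ (∣m+n∣m⇒∣n (≡.subst (_∣ k) g≡d (gcd[m,n]∣m k N)) (n∣m*n a))))))) (zeroˡ _)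
        where k = a ℕ.* d ℕ.+ suc e

module CirculantGraph (n' : ℕ) (D : List ℕ) where

  open import Data.Nat
  open import Data.Nat.Properties
  open import Data.Nat.DivMod
  open import Data.Nat.GCD using (gcd; gcd[m,n]∣m; gcd[m,n]∣n; gcd-greatest)
  open import Data.Nat.Divisibility using (_∣_; ∣⇒≤; ∣-antisym; ∣-refl)
  open import Data.Nat.Coprimality using (Coprime; 1-coprimeTo)
  open import Data.Fin as Fin using (Fin; zero; toℕ)
  open import Data.Fin.Properties using (toℕ<n; toℕ-injective; toℕ-fromℕ<)
  open import Data.List using (filter; downFrom)
  open import Data.List.Membership.Propositional using (_∈_)
  open import Data.List.Membership.Propositional.Properties using (∈-filter⁺; ∈-filter⁻; ∈-downFrom⁺; ∈-downFrom⁻)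
  open import Data.List.Relation.Unary.Unique.Propositional using (Unique)
  import Data.List.Relation.Unary.Unique.Propositional.Properties as Unique
  open import Relation.Nullary.Decidable using (_×-dec_)
  open import Function.Bundles using (_⇔_; mk⇔; Equivalence)
  open import Data.Product using (Σ; _×_; _,_; proj₁; proj₂)
  open import Data.Empty using (⊥-elim)
  open import Relation.Nullary using (¬_; Dec)
  open import Relation.Binary.PropositionalEquality
  open import Defs
  open Arithmetic

  N : ℕ
  N = suc n'

  toℕ-mod : ∀ x → toℕ (x mod N) ≡ x % N
  toℕ-mod x = toℕ-fromℕ< (m%n<n x N)

  toℕ-mod-injective : ∀ {a b : Fin N} → toℕ a % N ≡ toℕ b % N → a ≡ b
  toℕ-mod-injective {a} {b} e = toℕ-injective (%-injective-< (toℕ<n a) (toℕ<n b) e)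

  diffMod<N : ∀ a b → diffMod N a b < N
  diffMod<N a b = m%n<n (toℕ a + (N ∸ toℕ b)) N

  diffMod-+ : ∀ a b → (diffMod N a b + toℕ b) % N ≡ toℕ a
  diffMod-+ a b = begin
    ((toℕ a + (N ∸ toℕ b)) % N + toℕ b) % N ≡⟨ %-+-congʳ ((toℕ a + (N ∸ toℕ b)) % N) (toℕ a + (N ∸ toℕ b)) (toℕ b) (m%n%n≡m%n (toℕ a + (N ∸ toℕ b)) N) ⟩
    ((toℕ a + (N ∸ toℕ b)) + toℕ b) % N     ≡⟨ cong (_% N) (+-assoc (toℕ a) _ _) ⟩
    (toℕ a + ((N ∸ toℕ b) + toℕ b)) % N     ≡⟨ cong (λ z → (toℕ a + z) % N) (m∸n+n≡m (<⇒≤ (toℕ<n b))) ⟩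
    (toℕ a + N) % N                         ≡⟨ [m+n]%n≡m%n (toℕ a) N ⟩
    toℕ a % N                               ≡⟨ m<n⇒m%n≡m (toℕ<n a) ⟩
    toℕ a                                   ∎
    where open ≡-Reasoning

  diffMod-unique : ∀ a b {r} → r < N → (r + toℕ b) % N ≡ toℕ a → r ≡ diffMod N a b
  diffMod-unique a b {r} r<N e =
    %-injective-< r<N (diffMod<N a b) (%-+-cancelʳ r (diffMod N a b) (toℕ b) (trans e (sym (diffMod-+ a b))))

  gcd[k,N]<N : ∀ {k} → 1 ≤ k → k < N → gcd k N < N
  gcd[k,N]<N {k} 1≤k k<N = ≤-<-trans (∣⇒≤ {{>-nonZero 1≤k}} (gcd[m,n]∣m k N)) k<N

  affine : ℕ → ℕ → Fin N → Fin N
  affine u c x = (u * toℕ x + c) mod N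

  module _ {u : ℕ} (u⊥N : Coprime u N) (c : ℕ) where

    private
      φ = affine u c

    affine-injective : ∀ {a b} → φ a ≡ φ b → a ≡ b
    affine-injective {a} {b} φa≡φb = toℕ-mod-injective (begin
      toℕ a % N               ≡⟨ cong (_% N) (*-identityˡ (toℕ a)) ⟨
      (1 * toℕ a) % N         ≡⟨ %-*-congʳ (v * u) 1 (toℕ a) v*u≡1 ⟨
      (v * u * toℕ a) % N     ≡⟨ cong (_% N) (*-assoc v u (toℕ a)) ⟩
      (v * (u * toℕ a)) % N   ≡⟨ cong (_% N) (*-comm v _) ⟩
      (u * toℕ a * v) % N     ≡⟨ %-*-congʳ (u * toℕ a) (u * toℕ b) v ua≡ub ⟩
      (u * toℕ b * v) % N     ≡⟨ cong (_% N) (*-comm _ v) ⟩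
      (v * (u * toℕ b)) % N   ≡⟨ cong (_% N) (*-assoc v u (toℕ b)) ⟨
      (v * u * toℕ b) % N     ≡⟨ %-*-congʳ (v * u) 1 (toℕ b) v*u≡1 ⟩
      (1 * toℕ b) % N         ≡⟨ cong (_% N) (*-identityˡ (toℕ b)) ⟩
      toℕ b % N               ∎)
      where
      open ≡-Reasoning
      v = proj₁ (coprime⇒invertible u⊥N)
      v*u≡1 = proj₂ (coprime⇒invertible u⊥N)
      ua≡ub : (u * toℕ a) % N ≡ (u * toℕ b) % N
      ua≡ub = %-+-cancelʳ (u * toℕ a) (u * toℕ b) c
                (trans (sym (toℕ-mod (u * toℕ a + c))) (trans (cong toℕ φa≡φb) (toℕ-mod (u * toℕ b + c))))

    diffMod-affine : ∀ a b → diffMod N (φ a) (φ b) ≡ (u * diffMod N a b) % N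
    diffMod-affine a b = sym (diffMod-unique (φ a) (φ b) (m%n<n (u * d) N) (begin
      ((u * d) % N + toℕ (φ b)) % N            ≡⟨ cong (λ z → ((u * d) % N + z) % N) (toℕ-mod (u * toℕ b + c)) ⟩
      ((u * d) % N + (u * toℕ b + c) % N) % N  ≡⟨ %-distribˡ-+ (u * d) (u * toℕ b + c) N ⟨
      (u * d + (u * toℕ b + c)) % N            ≡⟨ cong (_% N) (sym (+-assoc (u * d) (u * toℕ b) c)) ⟩
      (u * d + u * toℕ b + c) % N              ≡⟨ cong (λ z → (z + c) % N) (sym (*-distribˡ-+ u d (toℕ b))) ⟩
      (u * (d + toℕ b) + c) % N                ≡⟨ %-+-congʳ (u * (d + toℕ b)) (u * toℕ a) c (u*-% (diffMod-+ a b)) ⟩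
      (u * toℕ a + c) % N                      ≡⟨ toℕ-mod (u * toℕ a + c) ⟨
      toℕ (φ a)                                ∎))
      where
      open ≡-Reasoning
      d = diffMod N a b
      u*-% : ∀ {x y} → x % N ≡ y → (u * x) % N ≡ (u * y) % N
      u*-% {x} {y} e = trans (cong (_% N) (*-comm u x))
                         (trans (%-*-congʳ x y u (trans e (sym (m<n⇒m%n≡m (subst (_< N) e (m%n<n x N))))))
                                (cong (_% N) (*-comm y u)))

    affine-adjacent : ∀ {a b} → Adj N D a b → Adj N D (φ a) (φ b)
    affine-adjacent {a} {b} (a≢b , gcd∈D) =
      (λ φa≡φb → a≢b (affine-injective φa≡φb)) ,
      subst (_∈ D) (begin
        gcd (diffMod N a b) N              ≡⟨ gcd[u*m,n]≡gcd[m,n] (diffMod N a b) u⊥N ⟨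
        gcd (u * diffMod N a b) N          ≡⟨ gcd[m%N,N]≡gcd[m,N] (u * diffMod N a b) ⟨
        gcd ((u * diffMod N a b) % N) N    ≡⟨ cong (λ z → gcd z N) (diffMod-affine a b) ⟨
        gcd (diffMod N (φ a) (φ b)) N      ∎) gcd∈D
      where open ≡-Reasoning

  walk-map : (φ : Fin N → Fin N) → (∀ {a b} → Adj N D a b → Adj N D (φ a) (φ b)) →
             ∀ {k a b} → Walk N D k a b → Walk N D k (φ a) (φ b)
  walk-map φ φ-adjacent nil            = nil
  walk-map φ φ-adjacent (cons adj walk) = cons (φ-adjacent adj) (walk-map φ φ-adjacent walk)

  module Distance (dist : Fin N → Fin N → ℕ) (isDist : IsDistFun N D dist) where

    dist-≤-walk : ∀ {k a b} → Walk N D k a b → dist a b ≤ k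
    dist-≤-walk {k} {a} {b} walk = ≮⇒≥ (λ k<dist → proj₂ (isDist a b) k k<dist walk)

    dist-refl : ∀ a → dist a a ≡ 0
    dist-refl a = n≤0⇒n≡0 (dist-≤-walk nil)

    dist-map : (φ : Fin N → Fin N) → (∀ {a b} → Adj N D a b → Adj N D (φ a) (φ b)) →
               ∀ a b → dist (φ a) (φ b) ≤ dist a b
    dist-map φ φ-adjacent a b = dist-≤-walk (walk-map φ φ-adjacent (proj₁ (isDist a b)))

    dist-affine : ∀ {u} → Coprime u N → ∀ c {a b a' b'} → affine u c a ≡ a' → affine u c b ≡ b' →
                  dist a' b' ≤ dist a b
    dist-affine {u} u⊥N c {a} {b} refl refl = dist-map (affine u c) (affine-adjacent u⊥N c) a b

    d₀ : ℕ → ℕ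
    d₀ k = dist zero (k mod N)

    dist-circulant : ∀ i j → dist i j ≡ d₀ (diffMod N j i)
    dist-circulant i j = ≤-antisym
      (dist-affine (1-coprimeTo N) (toℕ i) (toℕ-injective zero↦i) (toℕ-injective j-i↦j))
      (dist-affine (1-coprimeTo N) (N ∸ toℕ i) (toℕ-injective i↦zero) (toℕ-injective j↦j-i))
      where
      open ≡-Reasoning
      j-i = diffMod N j i
      i↦zero : toℕ (affine 1 (N ∸ toℕ i) i) ≡ 0
      i↦zero = begin
        toℕ (affine 1 (N ∸ toℕ i) i)    ≡⟨ toℕ-mod (1 * toℕ i + (N ∸ toℕ i)) ⟩
        (1 * toℕ i + (N ∸ toℕ i)) % N   ≡⟨ cong (λ z → (z + (N ∸ toℕ i)) % N) (*-identityˡ (toℕ i)) ⟩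
        (toℕ i + (N ∸ toℕ i)) % N       ≡⟨ cong (_% N) (m+[n∸m]≡n (<⇒≤ (toℕ<n i))) ⟩
        N % N                           ≡⟨ n%n≡0 N ⟩
        0                               ∎
      j↦j-i : toℕ (affine 1 (N ∸ toℕ i) j) ≡ toℕ (j-i mod N)
      j↦j-i = begin
        toℕ (affine 1 (N ∸ toℕ i) j)    ≡⟨ toℕ-mod (1 * toℕ j + (N ∸ toℕ i)) ⟩
        (1 * toℕ j + (N ∸ toℕ i)) % N   ≡⟨ cong (λ z → (z + (N ∸ toℕ i)) % N) (*-identityˡ (toℕ j)) ⟩
        j-i                             ≡⟨ m%n%n≡m%n (toℕ j + (N ∸ toℕ i)) N ⟨
        j-i % N                         ≡⟨ toℕ-mod j-i ⟨
        toℕ (j-i mod N)                 ∎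
      zero↦i : toℕ (affine 1 (toℕ i) zero) ≡ toℕ i
      zero↦i = trans (toℕ-mod (1 * 0 + toℕ i)) (m<n⇒m%n≡m (toℕ<n i))
      j-i↦j : toℕ (affine 1 (toℕ i) (j-i mod N)) ≡ toℕ j
      j-i↦j = begin
        toℕ (affine 1 (toℕ i) (j-i mod N))  ≡⟨ toℕ-mod (1 * toℕ (j-i mod N) + toℕ i) ⟩
        (1 * toℕ (j-i mod N) + toℕ i) % N   ≡⟨ cong (λ z → (z + toℕ i) % N) (trans (*-identityˡ _) (toℕ-mod j-i)) ⟩
        (j-i % N + toℕ i) % N               ≡⟨ cong (λ z → (z + toℕ i) % N) (m%n%n≡m%n (toℕ j + (N ∸ toℕ i)) N) ⟩
        (j-i + toℕ i) % N                   ≡⟨ diffMod-+ j i ⟩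
        toℕ j                               ∎

    dist-gcd-≤ : ∀ a b → gcd (toℕ a) N ≡ gcd (toℕ b) N → dist zero a ≤ dist zero b
    dist-gcd-≤ a b gcd≡ =
      let u , u⊥N , ub≡a = gcd≡⇒associated N (toℕ a) (toℕ b) (toℕ<n a) gcd≡
      in dist-affine u⊥N 0 {zero} {b}
           (toℕ-injective (trans (toℕ-mod (u * 0 + 0)) (cong (λ z → (z + 0) % N) (*-zeroʳ u))))
           (toℕ-injective (trans (toℕ-mod (u * toℕ b + 0)) (trans (cong (_% N) (+-identityʳ (u * toℕ b))) ub≡a)))

    dist-gcd : ∀ a b → gcd (toℕ a) N ≡ gcd (toℕ b) N → dist zero a ≡ dist zero b
    dist-gcd a b gcd≡ = ≤-antisym (dist-gcd-≤ a b gcd≡) (dist-gcd-≤ b a (sym gcd≡))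

    d₀-toℕ : ∀ k → d₀ (toℕ k) ≡ dist zero k
    d₀-toℕ k = cong (dist zero) (toℕ-injective (trans (toℕ-mod (toℕ k)) (m<n⇒m%n≡m (toℕ<n k))))

    d₀-gcd : ∀ {k} → 1 ≤ k → k < N → d₀ (gcd k N) ≡ d₀ k
    d₀-gcd {k} 1≤k k<N = dist-gcd (gcd k N mod N) (k mod N) (begin
      gcd (toℕ (gcd k N mod N)) N ≡⟨ cong (λ z → gcd z N) (trans (toℕ-mod (gcd k N)) (m<n⇒m%n≡m g<N)) ⟩
      gcd (gcd k N) N             ≡⟨ gcd[gcd[m,n],n]≡gcd[m,n] k N ⟩
      gcd k N                     ≡⟨ cong (λ z → gcd z N) (trans (toℕ-mod k) (m<n⇒m%n≡m k<N)) ⟨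
      gcd (toℕ (k mod N)) N       ∎)
      where
      open ≡-Reasoning
      g<N = gcd[k,N]<N 1≤k k<N

    IsLevelDivisor : ℕ → ℕ → Set
    IsLevelDivisor p d = gcd d N ≡ d × d₀ d ≡ p

    -- D⁽ᵖ⁾ of the paper; gcd d N ≡ d says that d divides N.
    isLevelDivisor? : ∀ p d → Dec (IsLevelDivisor p d)
    isLevelDivisor? p d = gcd d N ≟ d ×-dec d₀ d ≟ p

    levelDivisors : ℕ → List ℕ
    levelDivisors p = filter (isLevelDivisor? p) (downFrom N)

    levelDivisors-unique : ∀ p → Unique (levelDivisors p)
    levelDivisors-unique p = Unique.filter⁺ (isLevelDivisor? p) (Unique.downFrom⁺ N)

    ∈-levelDivisors⁻ : ∀ {p d} → d ∈ levelDivisors p → d < N × IsLevelDivisor p d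
    ∈-levelDivisors⁻ {p} d∈ = let d∈↓ , level = ∈-filter⁻ (isLevelDivisor? p) d∈ in ∈-downFrom⁻ d∈↓ , level

    ∈-levelDivisors⁺ : ∀ {p d} → d < N → IsLevelDivisor p d → d ∈ levelDivisors p
    ∈-levelDivisors⁺ {p} d<N = ∈-filter⁺ (isLevelDivisor? p) (∈-downFrom⁺ d<N)

    levelDivisor∣N : ∀ {p d} → d ∈ levelDivisors p → d ∣ N
    levelDivisor∣N {d = d} d∈ = subst (_∣ N) (proj₁ (proj₂ (∈-levelDivisors⁻ d∈))) (gcd[m,n]∣n d N)

    d₀≡p⇔gcd∈levelDivisors : ∀ p {k} → 1 ≤ k → k < N → (d₀ k ≡ p) ⇔ (gcd k N ∈ levelDivisors p)
    d₀≡p⇔gcd∈levelDivisors p {k} 1≤k k<N = mk⇔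
      (λ d₀k≡p → ∈-levelDivisors⁺ (gcd[k,N]<N 1≤k k<N) (gcd[gcd[m,n],n]≡gcd[m,n] k N , trans (d₀-gcd 1≤k k<N) d₀k≡p))
      (λ g∈ → trans (sym (d₀-gcd 1≤k k<N)) (proj₂ (proj₂ (∈-levelDivisors⁻ g∈))))

    dist≡p⇔∈G : ∀ p → 1 ≤ p → (k : Fin N) → (dist zero k ≡ p) ⇔ Σ ℕ (λ d → d ∈ levelDivisors p × InG N d k)
    dist≡p⇔∈G p 1≤p k = mk⇔ to from
      where
      level⇔ : 1 ≤ toℕ k → (d₀ (toℕ k) ≡ p) ⇔ (gcd (toℕ k) N ∈ levelDivisors p)
      level⇔ 1≤k = d₀≡p⇔gcd∈levelDivisors p 1≤k (toℕ<n k)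
      1≤k : ∀ {k} → dist zero k ≡ p → 1 ≤ toℕ k
      1≤k {zero}    dist≡p = ⊥-elim (<⇒≢ 1≤p (sym (trans (sym dist≡p) (dist-refl zero))))
      1≤k {Fin.suc _} _    = s≤s z≤n
      to : dist zero k ≡ p → Σ ℕ (λ d → d ∈ levelDivisors p × InG N d k)
      to dist≡p = gcd (toℕ k) N , Equivalence.to (level⇔ (1≤k dist≡p)) (trans (d₀-toℕ k) dist≡p) , 1≤k dist≡p , refl
      from : Σ ℕ (λ d → d ∈ levelDivisors p × InG N d k) → dist zero k ≡ p
      from (d , d∈ , 1≤k , gcd≡d) =
        trans (sym (d₀-toℕ k)) (Equivalence.from (level⇔ 1≤k) (subst (_∈ levelDivisors p) (sym gcd≡d) d∈))

module Spectrum {c ℓ : Level} (R : CommutativeRing c ℓ) (n' : ℕ) (D : List ℕ)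
  (dist : Fin (suc n') → Fin (suc n') → ℕ) (isDist : IsDistFun (suc n') D dist)
  (diam : ℕ) (isDiam : IsDiam (suc n') dist diam) where

  open import Data.Nat as ℕ using (zero; z≤n; s≤s; _≟_; _≤?_)
  import Data.Nat.Properties as ℕ
  open import Data.Nat.DivMod
  open import Data.Nat.GCD using (gcd)
  open import Data.Fin as Fin using (zero; toℕ)
  open import Data.Vec.Functional using (Vector)
  open import Data.Fin.Properties using (toℕ<n)
  open import Data.Product using (_×_; _,_; proj₁; proj₂)
  open import Relation.Nullary using (Dec; yes; no; does)
  open import Relation.Nullary.Decidable using (_×-dec_)
  open import Data.Bool using (if_then_else_)
  open import Function.Bundles using (Equivalence)
  open import Relation.Binary.PropositionalEquality as ≡ using (_≡_)
  open import Defs using (module RingDefs; diffMod; _/′_)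
  open Arithmetic using (%-+-congʳ; %-*-congʳ)

  open CommutativeRing R hiding (zero)
  open RingDefs R
  open Determinants R
  open FiniteSums R
  open CirculantGraph n' D
  open Distance dist isDist
  open import Relation.Binary.Reasoning.Setoid setoid
  open import Algebra.Properties.Ring ring using (-‿distribˡ-*; -‿distribʳ-*)
  open import Algebra.Solver.Ring.NaturalCoefficients.Default commutativeSemiring using (solve; _:*_; _:=_)

  module _ (ω : Carrier) (ωᴺ≈1 : pow ω N ≈ 1#) where

    pow-% : ∀ e → pow ω e ≈ pow ω (e % N)
    pow-% e = begin
      pow ω e                                   ≡⟨ ≡.cong (pow ω) (m≡m%n+[m/n]*n e N) ⟩
      pow ω (e % N ℕ.+ e / N ℕ.* N)             ≈⟨ pow-+ ω (e % N) (e / N ℕ.* N) ⟩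
      pow ω (e % N) * pow ω (e / N ℕ.* N)       ≈⟨ *-congˡ (pow-*N≈1 (e / N)) ⟩
      pow ω (e % N) * 1#                        ≈⟨ *-identityʳ _ ⟩
      pow ω (e % N)                             ∎
      where
      pow-*N≈1 : ∀ k → pow ω (k ℕ.* N) ≈ 1#
      pow-*N≈1 zero    = refl
      pow-*N≈1 (suc k) = trans (pow-+ ω N (k ℕ.* N)) (trans (*-cong ωᴺ≈1 (pow-*N≈1 k)) (*-identityˡ 1#))

    sumTo-rotate : ∀ c (g : ℕ → Carrier) → sumTo N (λ j → g ((j ℕ.+ c) % N)) ≈ sumTo N g
    sumTo-rotate zero g = sumTo-cong N (λ j j<N → reflexive (≡.cong g (≡.trans (≡.cong (_% N) (ℕ.+-identityʳ j)) (m<n⇒m%n≡m j<N))))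
    sumTo-rotate (suc c) g = begin
      sumTo N (λ j → g ((j ℕ.+ suc c) % N))
        ≈⟨ sumTo-cong N (λ j _ → reflexive (≡.cong g (≡.trans (%-+-congʳ ((j ℕ.+ 1) % N) (j ℕ.+ 1) c (m%n%n≡m%n (j ℕ.+ 1) N))
                                                             (≡.cong (_% N) (ℕ.+-assoc j 1 c))))) ⟨
      sumTo N (λ j → g (((j ℕ.+ 1) % N ℕ.+ c) % N))  ≈⟨ rotate₁ (λ y → g ((y ℕ.+ c) % N)) ⟩
      sumTo N (λ y → g ((y ℕ.+ c) % N))              ≈⟨ sumTo-rotate c g ⟩
      sumTo N g                                      ∎
      where
      rotate₁ : ∀ (g : ℕ → Carrier) → sumTo N (λ j → g ((j ℕ.+ 1) % N)) ≈ sumTo N g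
      rotate₁ g = begin
        sumTo N (λ j → g ((j ℕ.+ 1) % N))                    ≈⟨ sumTo-suc n' (λ j → g ((j ℕ.+ 1) % N)) ⟩
        sumTo n' (λ j → g ((j ℕ.+ 1) % N)) + g ((n' ℕ.+ 1) % N)
          ≈⟨ +-cong (sumTo-cong n' (λ j j<n' → reflexive (≡.cong g (≡.trans (≡.cong (_% N) (ℕ.+-comm j 1)) (m<n⇒m%n≡m (s≤s j<n'))))))
                    (reflexive (≡.cong g (≡.trans (≡.cong (_% N) (ℕ.+-comm n' 1)) (n%n≡0 N)))) ⟩
        sumTo n' (λ j → g (suc j)) + g 0                     ≈⟨ +-comm _ _ ⟩
        sumTo N g                                            ∎

    eigenvalue : ℕ → Carrier
    eigenvalue r = sumTo N (λ k → nat (d₀ k) * pow ω (k ℕ.* r))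

    -- Row i of the distance matrix is row 0 shifted by i, so the Fourier vectors are eigenvectors.
    dist-fourier : ∀ (i : Fin N) r → ∑ (λ j → nat (dist i j) * pow ω (toℕ j ℕ.* r)) ≈ pow ω (toℕ i ℕ.* r) * eigenvalue r
    dist-fourier i r = begin
      ∑ (λ j → nat (dist i j) * pow ω (toℕ j ℕ.* r))       ≈⟨ ∑-cong {N} summand ⟩
      ∑ {N} (λ j → ωⁱʳ * term ((toℕ j ℕ.+ N-i) % N))      ≈⟨ *-distribˡ-∑ {N} ωⁱʳ (λ j → term ((toℕ j ℕ.+ N-i) % N)) ⟨
      ωⁱʳ * sumTo N (λ j → term ((j ℕ.+ N-i) % N))        ≈⟨ *-congˡ (sumTo-rotate N-i term) ⟩
      ωⁱʳ * eigenvalue r                                   ∎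
      where
      ωⁱʳ = pow ω (toℕ i ℕ.* r)
      N-i = N ℕ.∸ toℕ i
      term : ℕ → Carrier
      term k = nat (d₀ k) * pow ω (k ℕ.* r)
      summand : ∀ j → nat (dist i j) * pow ω (toℕ j ℕ.* r) ≈ ωⁱʳ * term ((toℕ j ℕ.+ N-i) % N)
      summand j = begin
        nat (dist i j) * pow ω (toℕ j ℕ.* r)          ≡⟨ ≡.cong (λ z → nat z * pow ω (toℕ j ℕ.* r)) (dist-circulant i j) ⟩
        nat (d₀ m) * pow ω (toℕ j ℕ.* r)              ≈⟨ *-congˡ ωʲʳ≈ωⁱʳωᵐʳ ⟩
        nat (d₀ m) * (ωⁱʳ * pow ω (m ℕ.* r))          ≈⟨ solve 3 (λ a b c → a :* (b :* c) := b :* (a :* c)) refl _ _ _ ⟩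
        ωⁱʳ * term m                                  ∎
        where
        m = diffMod N j i
        i+m≡j : (toℕ i ℕ.+ m) % N ≡ toℕ j % N
        i+m≡j = ≡.trans (≡.cong (_% N) (ℕ.+-comm (toℕ i) m)) (≡.trans (diffMod-+ j i) (≡.sym (m<n⇒m%n≡m (toℕ<n j))))
        ωʲʳ≈ωⁱʳωᵐʳ : pow ω (toℕ j ℕ.* r) ≈ ωⁱʳ * pow ω (m ℕ.* r)
        ωʲʳ≈ωⁱʳωᵐʳ = begin
          pow ω (toℕ j ℕ.* r)                        ≈⟨ pow-% (toℕ j ℕ.* r) ⟩
          pow ω ((toℕ j ℕ.* r) % N)                  ≡⟨ ≡.cong (pow ω) (%-*-congʳ (toℕ i ℕ.+ m) (toℕ j) r i+m≡j) ⟨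
          pow ω (((toℕ i ℕ.+ m) ℕ.* r) % N)          ≈⟨ pow-% ((toℕ i ℕ.+ m) ℕ.* r) ⟨
          pow ω ((toℕ i ℕ.+ m) ℕ.* r)                ≡⟨ ≡.cong (pow ω) (ℕ.*-distribʳ-+ r (toℕ i) m) ⟩
          pow ω (toℕ i ℕ.* r ℕ.+ m ℕ.* r)            ≈⟨ pow-+ ω (toℕ i ℕ.* r) (m ℕ.* r) ⟩
          ωⁱʳ * pow ω (m ℕ.* r)                      ∎

    InG? : ∀ d k → Dec (1 ℕ.≤ k × gcd k N ≡ d)
    InG? d k = 1 ≤? k ×-dec gcd k N ≟ d

    𝟙-level≈sumL : ∀ p → 1 ℕ.≤ p → ∀ k → k ℕ.< N →
                   𝟙 (d₀ k ≟ p) ≈ sumL (levelDivisors p) (λ d → 𝟙 (InG? d k))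
    𝟙-level≈sumL p 1≤p zero _ = begin
      𝟙 (d₀ 0 ≟ p)                              ≈⟨ 𝟙-no (d₀ 0 ≟ p) (λ d₀0≡p → ℕ.<-irrefl (≡.trans (≡.sym (dist-refl zero)) d₀0≡p) 1≤p) ⟩
      0#                                        ≈⟨ sumL-≈0 (levelDivisors p) (λ d _ → 𝟙-no (InG? d 0) (λ ())) ⟨
      sumL (levelDivisors p) (λ d → 𝟙 (InG? d 0)) ∎
    𝟙-level≈sumL p 1≤p k@(suc _) k<N = begin
      𝟙 (d₀ k ≟ p)                                   ≈⟨ byLevel (d₀ k ≟ p) ⟩
      sumL (levelDivisors p) (λ d → 𝟙 (gcd k N ≟ d))  ≈⟨ sumL-cong (levelDivisors p) (λ d _ →
                                                           𝟙-cong (gcd k N ≟ d) (InG? d k) (s≤s z≤n ,_) proj₂) ⟩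
      sumL (levelDivisors p) (λ d → 𝟙 (InG? d k))     ∎
      where
      level⇔ = d₀≡p⇔gcd∈levelDivisors p (s≤s z≤n) k<N
      byLevel : (d₀k≟p : Dec (d₀ k ≡ p)) → 𝟙 d₀k≟p ≈ sumL (levelDivisors p) (λ d → 𝟙 (gcd k N ≟ d))
      byLevel (yes d₀k≡p) = sym (sumL-𝟙-∈ (levelDivisors-unique p) (Equivalence.to level⇔ d₀k≡p))
      byLevel (no d₀k≢p)  = sym (sumL-𝟙-∉ (levelDivisors p) (λ g∈ → d₀k≢p (Equivalence.from level⇔ g∈)))

    levelSum≈ramanujan : ∀ r p → 1 ℕ.≤ p →
      sumTo N (λ k → 𝟙 (d₀ k ≟ p) * pow ω (k ℕ.* r)) ≈ sumL (levelDivisors p) (λ d → ramanujan (pow ω d) r (N /′ d))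
    levelSum≈ramanujan r p 1≤p = begin
      sumTo N (λ k → 𝟙 (d₀ k ≟ p) * pow ω (k ℕ.* r))
        ≈⟨ sumTo-cong N (λ k k<N → trans (*-congʳ (𝟙-level≈sumL p 1≤p k k<N))
                                          (*-distribʳ-sumL (levelDivisors p) (λ d → 𝟙 (InG? d k)) (pow ω (k ℕ.* r)))) ⟩
      sumTo N (λ k → sumL (levelDivisors p) (λ d → 𝟙 (InG? d k) * pow ω (k ℕ.* r)))
        ≈⟨ sumTo-sumL (levelDivisors p) N (λ d k → 𝟙 (InG? d k) * pow ω (k ℕ.* r)) ⟩
      sumL (levelDivisors p) (λ d → sumTo N (λ k → 𝟙 (InG? d k) * pow ω (k ℕ.* r)))
        ≈⟨ sumL-cong (levelDivisors p) (λ d d∈ → ∑-G≈ramanujan N d r ω (levelDivisor∣N d∈) (proj₁ (∈-levelDivisors⁻ d∈))) ⟩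
      sumL (levelDivisors p) (λ d → ramanujan (pow ω d) r (N /′ d)) ∎

    eigenvalue≈mu : ∀ r → eigenvalue r ≈ mu N ω levelDivisors diam r
    eigenvalue≈mu r = begin
      sumTo N (λ k → nat (d₀ k) * ωᵏʳ k)
        ≈⟨ sumTo-cong N {h' = λ k → sumTo diam (λ q → F k q)} (λ k _ →
             trans (*-congʳ (nat-≈-sumTo diam (d₀ k) (proj₁ isDiam zero (k mod N))))
                   (*-distribʳ-∑ {diam} (ωᵏʳ k) (λ q → nat (suc (toℕ q)) * 𝟙 (d₀ k ≟ suc (toℕ q))))) ⟩
      sumTo N (λ k → sumTo diam (λ q → F k q))
        ≈⟨ ∑-swap {N} {diam} (λ k q → F (toℕ k) (toℕ q)) ⟩
      sumTo diam (λ q → sumTo N (λ k → F k q))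
        ≈⟨ sumTo-cong diam {h' = λ q → nat (suc q) * sumTo N (λ k → 𝟙 (d₀ k ≟ suc q) * ωᵏʳ k)} (λ q _ →
             trans (∑-cong {N} (λ k → *-assoc (nat (suc q)) (𝟙 (d₀ (toℕ k) ≟ suc q)) (ωᵏʳ (toℕ k))))
                   (sym (*-distribˡ-∑ {N} (nat (suc q)) (λ k → 𝟙 (d₀ (toℕ k) ≟ suc q) * ωᵏʳ (toℕ k))))) ⟩
      sumTo diam (λ q → nat (suc q) * sumTo N (λ k → 𝟙 (d₀ k ≟ suc q) * ωᵏʳ k))
        ≈⟨ sumTo-cong diam (λ q _ → *-congˡ {nat (suc q)} (levelSum≈ramanujan r (suc q) (s≤s z≤n))) ⟩
      mu N ω levelDivisors diam r ∎
      where
      ωᵏʳ : ℕ → Carrier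
      ωᵏʳ k = pow ω (k ℕ.* r)
      F : ℕ → ℕ → Carrier
      F k q = nat (suc q) * 𝟙 (d₀ k ≟ suc q) * ωᵏʳ k

  if≟-δ : ∀ {m} (i j : Fin m) x → (if does (i Fin.≟ j) then x else 0#) ≈ δ i j * x
  if≟-δ i j x with i Fin.≟ j
  ... | yes ≡.refl = sym (trans (*-congʳ (δ-refl i)) (*-identityˡ x))
  ... | no i≢j    = sym (trans (*-congʳ (δ-≢ i≢j)) (zeroˡ x))

  distanceSpectrum : DistanceSpectrum N dist levelDivisors diam
  distanceSpectrum isField ω ω-primitive x =
    det-fourierEigenbasis ω-primitive (λ i j → (if does (i Fin.≟ j) then x else 0#) - nat (dist i j)) μ eigen
    where
    open FieldTheory isField
    μ : Vector Carrier N
    μ r = x - mu N ω levelDivisors diam (toℕ r)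
    eigen : ∀ i r → ∑ (λ j → ((if does (i Fin.≟ j) then x else 0#) - nat (dist i j)) * pow ω (toℕ j ℕ.* toℕ r))
                    ≈ pow ω (toℕ i ℕ.* toℕ r) * μ r
    eigen i r = begin
      ∑ (λ j → ((if does (i Fin.≟ j) then x else 0#) - nat (dist i j)) * ωʲʳ j)
        ≈⟨ ∑-cong {N} (λ j → trans (distribʳ (ωʲʳ j) _ _) (+-cong (trans (*-congʳ (if≟-δ i j x)) (*-assoc _ _ _))
                                                                    (sym (-‿distribˡ-* (nat (dist i j)) (ωʲʳ j))))) ⟩
      ∑ (λ j → δ i j * (x * ωʲʳ j) + - (nat (dist i j) * ωʲʳ j))
        ≈⟨ ∑-+ {N} (λ j → δ i j * (x * ωʲʳ j)) (λ j → - (nat (dist i j) * ωʲʳ j)) ⟩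
      ∑ (λ j → δ i j * (x * ωʲʳ j)) + ∑ (λ j → - (nat (dist i j) * ωʲʳ j))
        ≈⟨ +-cong (∑-δ*ˡ (λ j → x * ωʲʳ j) i)
                  (trans (-‿distrib-∑ {N} (λ j → nat (dist i j) * ωʲʳ j))
                         (-‿cong (trans (dist-fourier ω (proj₁ ω-primitive) i (toℕ r))
                                        (*-congˡ (eigenvalue≈mu ω (proj₁ ω-primitive) (toℕ r)))))) ⟩
      x * ωʲʳ i + - (ωʲʳ i * mu N ω levelDivisors diam (toℕ r))
        ≈⟨ +-cong (*-comm _ _) (-‿distribʳ-* _ _) ⟩
      ωʲʳ i * x + ωʲʳ i * - mu N ω levelDivisors diam (toℕ r)
        ≈⟨ distribˡ _ _ _ ⟨
      ωʲʳ i * μ r ∎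
      where
      ωʲʳ : Fin N → Carrier
      ωʲʳ j = pow ω (toℕ j ℕ.* toℕ r)

mainTheorem2 : {c ℓ : Level} (n : ℕ) (n>1 : 1 < n) (D : List ℕ) →
    All (λ d → 1 ≤ d × d < n × d ∣ n) D →
    Connected n D →
    (dist : Fin n → Fin n → ℕ) → IsDistFun n D dist →
    (diam : ℕ) → IsDiam n dist diam →
    ((a b : Fin n) → gcd (toℕ a) n ≡ gcd (toℕ b) n →
       dist (vzero n>1) a ≡ dist (vzero n>1) b)
    × Σ (ℕ → List ℕ) (λ Dp →
        (∀ p → All (λ d → d ∣ n) (Dp p))
        × (∀ p → 1 ≤ p → (k : Fin n) →
             (dist (vzero n>1) k ≡ p) ⇔ Σ ℕ (λ d → d ∈ Dp p × InG n d k))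
        × ((R : CommutativeRing c ℓ) → RingDefs.DistanceSpectrum R n dist Dp diam))
-- Connectivity of ICG_n(D) and the conditions on D are implicit in the existence of dist.
mainTheorem2 (suc n') _ D _ _ dist isDist diam isDiam =
  dist-gcd ,
  levelDivisors ,
  (λ p → All.tabulate levelDivisor∣N) ,
  dist≡p⇔∈G ,
  (λ R → Spectrum.distanceSpectrum R n' D dist isDist diam isDiam)
  where
  open CirculantGraph n' D
  open Distance dist isDist
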